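{- Let $n\in\mathbb{N}$ and let $d_1 \geq d_2 \geq \dots \geq d_n \geq 1$ be integers. There exists a simple graph $G$ with vertex set $[n]=\{1,\ldots,n\}$ such that $\deg_G(i)=d_i$ for all $i\in[n]$ and $G$ contains all the edges $(1,2),(3,4),\ldots,(n-1,n)$ (i.e. the perfect matching $M^+=\{(1,2),(3,4),\ldots,(n-1,n)\}$) if and only if $\sum_{i=1}^n d_i$ is even, $n$ is even, and for every $k\in[n]$: $$\sum_{i=1}^k d_i \leq \begin{cases} k(k-1)+\sum_{i=k+1}^n \min\{d_i-1,k\} & \text{if } k \text{ is even},\\ k(k-1)+\min\{d_{k+1},k\}+\sum_{i=k+2}^n \min\{d_i-1,k\} & \text{if } k \text{ is odd}.\end{cases}$$
   Context: $(i,j)$ denotes the edge between vertices $i$ and $j$. Empty sums are $0$. -}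

module Defs where

open import Data.Nat using (ℕ; zero; suc; _+_; _*_; _∸_; _⊓_; _≤_; _<_)
open import Data.Nat.Divisibility using (_∣_)
open import Data.Bool using (Bool; true; false; if_then_else_)

open import Data.Fin using (Fin; toℕ)
import Data.Fin as Fin
open import Data.Fin.Properties using () 
open import Data.List using (List; map; upTo; allFin)
open import Data.Nat.ListAction using (sum)
open import Data.Product using (_×_; ∃-syntax)
open import Relation.Binary.PropositionalEquality using (_≡_)
open import Relation.Nullary using (¬_)

-- A simple graph on vertex set Fin n (vertex i of Fin n is vertex i+1 of [n]):
-- a symmetric, irreflexive Boolean adjacency relation.
record SimpleGraph (n : ℕ) : Set where
  field
    adj   : Fin n → Fin n → Bool
    sym   : ∀ i j → adj i j ≡ adj j i
    irrfl : ∀ i → adj i i ≡ false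
open SimpleGraph public

deg : ∀ {n} → SimpleGraph n → Fin n → ℕ
deg {n} G i = sum (map (λ j → (if adj G i j then 1 else 0)) (allFin n))

-- partner of a 0-indexed vertex in M⁺ = {(0,1),(2,3),...}
-- (0-indexed version of {(1,2),(3,4),...})
partner : ℕ → ℕ
partner zero = 1
partner (suc zero) = 0
partner (suc (suc m)) = suc (suc (partner m))

ContainsM⁺ : ∀ {n} → SimpleGraph n → Set
ContainsM⁺ {n} G = ∀ (i : Fin n) → ∃[ j ] (toℕ j ≡ partner (toℕ i) × adj G i j ≡ true)

-- 1-indexed extension of d : Fin n → ℕ to ℕ; dd i = d_i for 1 ≤ i ≤ n, 0 otherwise
ext : ∀ {n} → (Fin n → ℕ) → ℕ → ℕ
ext {zero}  d i = 0
ext {suc n} d zero = 0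
ext {suc n} d (suc zero) = d Fin.zero
ext {suc n} d (suc (suc i)) = ext {n} (λ j → d (Fin.suc j)) (suc i)

-- Σ_{i=a}^{b} f i  (empty if b < a)
sumFT : (ℕ → ℕ) → ℕ → ℕ → ℕ
sumFT f a b = sum (map (λ t → f (a + t)) (upTo (suc b ∸ a)))

NonIncreasing : ∀ {n} → (Fin n → ℕ) → Set
NonIncreasing {n} d = ∀ (i j : Fin n) → toℕ i ≤ toℕ j → d j ≤ d i

isEven : ℕ → Bool
isEven zero = true
isEven (suc zero) = false
isEven (suc (suc m)) = isEven m

-- right hand side of the k-th inequality (k 1-indexed), D = ext d
bound : ∀ {n} → (Fin n → ℕ) → ℕ → ℕ
bound {n} d k =
  k * (k ∸ 1) +
  (if isEven k
     then sumFT (λ i → (ext d i ∸ 1) ⊓ k) (suc k) n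
     else (ext d (suc k) ⊓ k) + sumFT (λ i → (ext d i ∸ 1) ⊓ k) (suc (suc k)) n)

{-# OPTIONS --safe #-}
-- Necessity is double counting on the first k vertices: each of them has at most k − 1
-- neighbours among them, and a later vertex y has at most min(k, d_y − [the M⁺-partner of y is
-- later too]) neighbours among them.
--
-- Sufficiency is constructive. Starting from M⁺, the vertices are saturated one at a time, in
-- order, keeping M⁺ inside the graph, every degree at most its target and all earlier vertices
-- saturated. While the current vertex v is deficient, one of seven edge switches either raises
-- deg v, or keeps it and adds an edge among the earlier vertices. If none applies, then v and the
-- earlier vertices form a clique, every later vertex has as many neighbours in it as the bound
-- allows, and the deficiency of v violates the inequality for the prefix ending at v. When v
-- lacks a single edge, the parity of Σ d provides a deficient later vertex to switch with.

module Submission where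

open import Defs hiding (sym)
open import Data.Bool using (Bool; true; false; if_then_else_; _∧_; _∨_; not)
open import Data.Bool.Properties using (∧-zeroʳ; ∧-identityʳ; ∧-comm; ∧-inverseʳ; ∨-comm) renaming (_≟_ to _≟ᵇ_)
open import Data.Empty using (⊥; ⊥-elim)
open import Data.Fin as Fin using (Fin; toℕ; fromℕ<)
open import Data.Fin.Properties using (toℕ-injective; toℕ-fromℕ<; toℕ<n; punchInᵢ≢i; any?)
  renaming (_≟_ to _≟ᶠ_; <-cmp to <-cmpᶠ)
open import Data.List using (map; allFin; tabulate; applyUpTo)
open import Data.List.Properties using (map-tabulate; map-upTo)
open import Data.Nat
open import Data.Nat.Divisibility using (_∣_; divides; ∣m∣n⇒∣m+n; ∣m+n∣m⇒∣n; ∣1⇒≡1)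
open import Data.Nat.Induction using (<-wellFounded)
import Data.Nat.ListAction as List
open import Data.Nat.Properties
open import Algebra.Properties.Semiring.Sum +-*-semiring
  using (sum; ∑-distrib-+; ∑-comm; sum-cong-≗; sum-replicate-zero; sum-remove; *-distribʳ-sum)
open import Data.Product using (Σ-syntax; _×_; _,_; ∃; ∃-syntax; proj₁; proj₂)
open import Data.Product.Function.NonDependent.Propositional using (_×-⇔_)
open import Data.Product.Relation.Binary.Lex.Strict using (×-Lex; ×-wellFounded)
open import Data.Sum using (inj₁; inj₂)
open import Data.Vec.Functional using (removeAt)
open import Function using (_∘_; id; _on_)
open import Function.Bundles using (_⇔_; mk⇔)
open import Function.Properties.Equivalence using () renaming (refl to ⇔-refl; trans to ⇔-trans)
open import Induction.WellFounded using (WellFounded; Acc; acc)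
open import Relation.Binary using (Tri; tri<; tri≈; tri>)
import Relation.Binary.Construct.On as On
open import Relation.Binary.PropositionalEquality
open import Relation.Nullary using (¬_; Dec; yes; no; does; contradiction; ¬?)
open import Relation.Nullary.Decidable using (dec-true; dec-false; _×-dec_)

𝟙 : Bool → ℕ
𝟙 b = if b then 1 else 0

𝟙≤1 : ∀ b → 𝟙 b ≤ 1
𝟙≤1 true  = ≤-refl
𝟙≤1 false = z≤n

∧-trueˡ : ∀ {a b} → a ∧ b ≡ true → a ≡ true
∧-trueˡ {true} _ = refl

∧-trueʳ : ∀ {a b} → a ∧ b ≡ true → b ≡ true
∧-trueʳ {true} e = e

∧-true : ∀ {a b} → a ≡ true → b ≡ true → a ∧ b ≡ true
∧-true refl refl = refl

∧-falseˡ : ∀ {a b} → a ∧ b ≡ false → b ≡ true → a ≡ false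
∧-falseˡ {false} _   _    = refl
∧-falseˡ {true}  a∧b refl = a∧b

not-true : ∀ {a} → not a ≡ true → a ≡ false
not-true {false} _ = refl

does-true : ∀ {a} {A : Set a} (a? : Dec A) → does a? ≡ true → A
does-true (yes a) _ = a

does-false : ∀ {a} {A : Set a} (a? : Dec A) → does a? ≡ false → ¬ A
does-false (no ¬a) _ = ¬a

<ᵇ-true : ∀ {m n} → m < n → (m <ᵇ n) ≡ true
<ᵇ-true = dec-true (_ <? _)

<ᵇ-false : ∀ {m n} → n ≤ m → (m <ᵇ n) ≡ false
<ᵇ-false = dec-false (_ <? _) ∘ ≤⇒≯

<ᵇ-true⁻¹ : ∀ {m n} → (m <ᵇ n) ≡ true → m < n
<ᵇ-true⁻¹ = does-true (_ <? _)

<ᵇ-false⁻¹ : ∀ {m n} → (m <ᵇ n) ≡ false → n ≤ m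
<ᵇ-false⁻¹ = ≮⇒≥ ∘ does-false (_ <? _)

m<n∸o⇒m+o<n : ∀ {m} n o → m < n ∸ o → m + o < n
m<n∸o⇒m+o<n {m} n       zero    m<n   = subst (_< n) (sym (+-identityʳ m)) m<n
m<n∸o⇒m+o<n {m} (suc n) (suc o) m<n∸o = s≤s (subst (_≤ n) (sym (+-suc m o)) (m<n∸o⇒m+o<n n o m<n∸o))

module _ {n : ℕ} where

  _==_ : Fin n → Fin n → Bool
  x == y = does (x ≟ᶠ y)

  ==-refl : ∀ x → (x == x) ≡ true
  ==-refl x = dec-true (x ≟ᶠ x) refl

  ==-≢ : ∀ {x y} → x ≢ y → (x == y) ≡ false
  ==-≢ = dec-false (_ ≟ᶠ _)

  ==-false⁻¹ : ∀ {x y} → (x == y) ≡ false → x ≢ y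
  ==-false⁻¹ = does-false (_ ≟ᶠ _)

any²? : ∀ {n} {P : Fin n → Fin n → Set} → (∀ x y → Dec (P x y)) → Dec (∃ λ x → ∃ (P x))
any²? P? = any? λ x → any? (P? x)

any³? : ∀ {n} {P : Fin n → Fin n → Fin n → Set} → (∀ x y z → Dec (P x y z)) → Dec (∃ λ x → ∃ λ y → ∃ (P x y))
any³? P? = any? λ x → any²? (P? x)

any⁴? : ∀ {n} {P : Fin n → Fin n → Fin n → Fin n → Set} → (∀ x y z w → Dec (P x y z w)) →
        Dec (∃ λ x → ∃ λ y → ∃ λ z → ∃ (P x y z))
any⁴? P? = any? λ x → any³? (P? x)

-- Finite sums and counting

sum-mono-≤ : ∀ {n} {f g : Fin n → ℕ} → (∀ x → f x ≤ g x) → sum f ≤ sum g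
sum-mono-≤ {zero}  f≤g = z≤n
sum-mono-≤ {suc n} f≤g = +-mono-≤ (f≤g Fin.zero) (sum-mono-≤ (f≤g ∘ Fin.suc))

sum-mono-< : ∀ {n} {f g : Fin n → ℕ} (v : Fin n) → (∀ x → f x ≤ g x) → f v < g v → sum f < sum g
sum-mono-< Fin.zero    f≤g fv<gv = +-mono-<-≤ fv<gv (sum-mono-≤ (f≤g ∘ Fin.suc))
sum-mono-< (Fin.suc v) f≤g fv<gv = +-mono-≤-< (f≤g Fin.zero) (sum-mono-< v (f≤g ∘ Fin.suc) fv<gv)

sum-zero : ∀ {n} {f : Fin n → ℕ} → (∀ x → f x ≡ 0) → sum f ≡ 0
sum-zero {n} f≡0 = trans (sum-cong-≗ f≡0) (sum-replicate-zero n)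

sum-single : ∀ {n} (f : Fin n → ℕ) (v : Fin n) → (∀ x → x ≢ v → f x ≡ 0) → sum f ≡ f v
sum-single {suc n} f v elsewhere = begin
  sum f                          ≡⟨ sum-remove {i = v} f ⟩
  f v + sum (removeAt f v)      ≡⟨ cong (f v +_) (sum-zero (λ x → elsewhere _ (punchInᵢ≢i v x))) ⟩
  f v + 0                        ≡⟨ +-identityʳ (f v) ⟩
  f v                            ∎
  where open ≡-Reasoning

list-sum-allFin : ∀ {n} (f : Fin n → ℕ) → List.sum (map f (allFin n)) ≡ sum f
list-sum-allFin {n} f = trans (cong List.sum (map-tabulate id f)) (sum-tabulate f)
  where
  sum-tabulate : ∀ {n} (f : Fin n → ℕ) → List.sum (tabulate f) ≡ sum f
  sum-tabulate {zero}  f = refl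
  sum-tabulate {suc n} f = cong (f Fin.zero +_) (sum-tabulate (f ∘ Fin.suc))

sumOver : ∀ {n} → (Fin n → Bool) → (Fin n → ℕ) → ℕ
sumOver P f = sum (λ x → if P x then f x else 0)

count : ∀ {n} → (Fin n → Bool) → ℕ
count p = sum (𝟙 ∘ p)

sumOver-mono-≤ : ∀ {n} (P : Fin n → Bool) {f g : Fin n → ℕ} →
                 (∀ x → P x ≡ true → f x ≤ g x) → sumOver P f ≤ sumOver P g
sumOver-mono-≤ P f≤g = sum-mono-≤ pointwise
  where
  pointwise : ∀ x → (if P x then _ else 0) ≤ (if P x then _ else 0)
  pointwise x with P x in Px
  ... | true  = f≤g x Px
  ... | false = z≤n

sumOver-cong : ∀ {n} (P : Fin n → Bool) {f g : Fin n → ℕ} → (∀ x → P x ≡ true → f x ≡ g x) → sumOver P f ≡ sumOver P g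
sumOver-cong P f≡g = sum-cong-≗ pointwise
  where
  pointwise : ∀ x → (if P x then _ else 0) ≡ (if P x then _ else 0)
  pointwise x with P x in Px
  ... | true  = f≡g x Px
  ... | false = refl

sumOver-+ : ∀ {n} (P : Fin n → Bool) (f g : Fin n → ℕ) →
            sumOver P (λ x → f x + g x) ≡ sumOver P f + sumOver P g
sumOver-+ P f g = trans (sum-cong-≗ pointwise) (∑-distrib-+ (λ x → if P x then f x else 0) _)
  where
  pointwise : ∀ x → (if P x then f x + g x else 0) ≡ (if P x then f x else 0) + (if P x then g x else 0)
  pointwise x with P x
  ... | true  = refl
  ... | false = refl

sumOver-const : ∀ {n} (P : Fin n → Bool) (c : ℕ) → sumOver P (λ _ → c) ≡ count P * c
sumOver-const P c = trans (sum-cong-≗ pointwise) (sym (*-distribʳ-sum c (𝟙 ∘ P)))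
  where
  pointwise : ∀ x → (if P x then c else 0) ≡ 𝟙 (P x) * c
  pointwise x with P x
  ... | true  = sym (+-identityʳ c)
  ... | false = refl

count-split : ∀ {n} (p q : Fin n → Bool) →
              count p ≡ count (λ y → p y ∧ q y) + count (λ y → p y ∧ not (q y))
count-split p q = trans (sum-cong-≗ pointwise) (∑-distrib-+ (λ y → 𝟙 (p y ∧ q y)) _)
  where
  pointwise : ∀ y → 𝟙 (p y) ≡ 𝟙 (p y ∧ q y) + 𝟙 (p y ∧ not (q y))
  pointwise y with p y | q y
  ... | true  | true  = refl
  ... | true  | false = refl
  ... | false | _     = refl

count-mono : ∀ {n} {p q : Fin n → Bool} → (∀ y → p y ≡ true → q y ≡ true) → count p ≤ count q
count-mono {p = p} {q} p⊆q = sum-mono-≤ pointwise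
  where
  pointwise : ∀ y → 𝟙 (p y) ≤ 𝟙 (q y)
  pointwise y with p y in py
  ... | true  rewrite p⊆q y py = ≤-refl
  ... | false = z≤n

count-∧-≤ʳ : ∀ {n} (p q : Fin n → Bool) → count (λ y → p y ∧ q y) ≤ count q
count-∧-≤ʳ p q = count-mono (λ y → ∧-trueʳ {p y})

count-witness : ∀ {n} (p : Fin n → Bool) → 0 < count p → ∃ λ y → p y ≡ true
count-witness {suc n} p pos with p Fin.zero in p0
... | true  = Fin.zero , p0
... | false = let y , py = count-witness (p ∘ Fin.suc) pos in Fin.suc y , py

count-<-witness : ∀ {n} (p q : Fin n → Bool) → count p < count q → ∃ λ y → q y ≡ true × p y ≡ false
count-<-witness p q p<q =
  let y , qy∧¬py = count-witness (λ y → q y ∧ not (p y)) pos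
  in y , ∧-trueˡ qy∧¬py , not-true (∧-trueʳ {q y} qy∧¬py)
  where
  pos : 0 < count (λ y → q y ∧ not (p y))
  pos = +-cancelˡ-< (count (λ y → q y ∧ p y)) 0 _ (begin-strict
    count (λ y → q y ∧ p y) + 0  ≡⟨ +-identityʳ _ ⟩
    count (λ y → q y ∧ p y)      ≤⟨ count-∧-≤ʳ q p ⟩
    count p                      <⟨ p<q ⟩
    count q                      ≡⟨ count-split q p ⟩
    count (λ y → q y ∧ p y) + count (λ y → q y ∧ not (p y)) ∎)
    where open ≤-Reasoning

count-split-at : ∀ {n} (p : Fin n → Bool) (v : Fin n) → count p ≡ 𝟙 (p v) + count (λ y → p y ∧ not (y == v))
count-split-at p v = trans (count-split p (_== v)) (cong (_+ count (λ y → p y ∧ not (y == v))) (trans (sum-single _ v off-v) at-v))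
  where
  off-v : ∀ y → y ≢ v → 𝟙 (p y ∧ (y == v)) ≡ 0
  off-v y y≢v rewrite ==-≢ y≢v | ∧-zeroʳ (p y) = refl
  at-v : 𝟙 (p v ∧ (v == v)) ≡ 𝟙 (p v)
  at-v rewrite ==-refl v | ∧-identityʳ (p v) = refl

𝟙≤count : ∀ {n} (p : Fin n → Bool) (v : Fin n) → 𝟙 (p v) ≤ count p
𝟙≤count p v = ≤-trans (m≤m+n _ _) (≤-reflexive (sym (count-split-at p v)))

count-pos : ∀ {n} (p : Fin n → Bool) {v : Fin n} → p v ≡ true → 0 < count p
count-pos p {v} pv = subst (λ b → 𝟙 b ≤ count p) pv (𝟙≤count p v)

count-≤-except : ∀ {n} (p q : Fin n → Bool) (v : Fin n) →
                 (∀ y → p y ≡ true → y ≢ v → q y ≡ true) → count p ≤ 1 + count q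
count-≤-except p q v p⊆q∪v = begin
  count p                                    ≡⟨ count-split-at p v ⟩
  𝟙 (p v) + count (λ y → p y ∧ not (y == v)) ≤⟨ +-mono-≤ (𝟙≤1 (p v)) (count-mono sub) ⟩
  1 + count q                                ∎
  where
  open ≤-Reasoning
  sub : ∀ y → p y ∧ not (y == v) ≡ true → q y ≡ true
  sub y e = p⊆q∪v y (∧-trueˡ e) (==-false⁻¹ (not-true (∧-trueʳ {p y} e)))

count-mono-< : ∀ {n} {p q : Fin n → Bool} (v : Fin n) →
            (∀ y → p y ≡ true → q y ≡ true) → q v ≡ true → p v ≡ false → 1 + count p ≤ count q
count-mono-< {p = p} {q} v p⊆q qv pv = begin
  1 + count p                                 ≤⟨ +-monoʳ-≤ 1 (count-mono sub) ⟩
  1 + count (λ y → q y ∧ not (y == v))        ≡⟨ cong (λ b → 𝟙 b + count (λ y → q y ∧ not (y == v))) qv ⟨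
  𝟙 (q v) + count (λ y → q y ∧ not (y == v))  ≡⟨ count-split-at q v ⟨
  count q                                     ∎
  where
  open ≤-Reasoning
  sub : ∀ y → p y ≡ true → q y ∧ not (y == v) ≡ true
  sub y py = ∧-true (p⊆q y py) (cong not (==-≢ {x = y} λ { refl → contradiction (trans (sym py) pv) λ () }))

count-witness-≢ : ∀ {n} (p : Fin n → Bool) (v : Fin n) → 𝟙 (p v) < count p → ∃ λ y → y ≢ v × p y ≡ true
count-witness-≢ p v lt =
  let y , e = count-witness (λ y → p y ∧ not (y == v))
                (+-cancelˡ-< (𝟙 (p v)) 0 _ (<-≤-trans (≤-<-trans (≤-reflexive (+-identityʳ _)) lt)
                                                       (≤-reflexive (count-split-at p v))))
  in y , ==-false⁻¹ (not-true (∧-trueʳ {p y} e)) , ∧-trueˡ e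

count-below : ∀ {n} r → r ≤ n → count {n} (λ y → toℕ y <ᵇ r) ≡ r
count-below {n}     zero    _         = sum-zero {n} (λ _ → refl)
count-below {suc n} (suc r) (s≤s r≤n) = cong suc (count-below r r≤n)

count-change : ∀ {n} (p q : Fin n → Bool) (v : Fin n) → (∀ y → y ≢ v → p y ≡ q y) →
               count p + 𝟙 (q v) ≡ count q + 𝟙 (p v)
count-change {n} p q v agree = begin
  count p + 𝟙 (q v)               ≡⟨ cong (_+ 𝟙 (q v)) (count-split-at p v) ⟩
  𝟙 (p v) + rest p + 𝟙 (q v)      ≡⟨ cong (λ r → 𝟙 (p v) + r + 𝟙 (q v)) (sum-cong-≗ same-rest) ⟩
  𝟙 (p v) + rest q + 𝟙 (q v)      ≡⟨ +-comm (𝟙 (p v) + rest q) _ ⟩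
  𝟙 (q v) + (𝟙 (p v) + rest q)    ≡⟨ cong (𝟙 (q v) +_) (+-comm (𝟙 (p v)) _) ⟩
  𝟙 (q v) + (rest q + 𝟙 (p v))    ≡⟨ +-assoc (𝟙 (q v)) _ _ ⟨
  𝟙 (q v) + rest q + 𝟙 (p v)      ≡⟨ cong (_+ 𝟙 (p v)) (count-split-at q v) ⟨
  count q + 𝟙 (p v)               ∎
  where
  open ≡-Reasoning
  rest : (Fin n → Bool) → ℕ
  rest r = count (λ y → r y ∧ not (y == v))
  same-rest : ∀ y → 𝟙 (p y ∧ not (y == v)) ≡ 𝟙 (q y ∧ not (y == v))
  same-rest y with y ≟ᶠ v
  ... | yes refl rewrite ∧-zeroʳ (p y) | ∧-zeroʳ (q y) = refl
  ... | no y≢v   rewrite agree y y≢v = refl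

2∣m+m : ∀ m → 2 ∣ m + m
2∣m+m m = divides m (trans (cong (m +_) (sym (+-identityʳ m))) (*-comm 2 m))

sum-symmetric-even : ∀ {n} (h : Fin n → Fin n → ℕ) → (∀ x y → h x y ≡ h y x) → (∀ x → h x x ≡ 0) →
                     2 ∣ sum (λ x → sum (h x))
sum-symmetric-even {zero}  h h-sym h-diag = divides 0 refl
sum-symmetric-even {suc n} h h-sym h-diag =
  subst (2 ∣_) (sym regroup) (∣m∣n⇒∣m+n (2∣m+m a) (sum-symmetric-even h′ (λ x y → h-sym _ _) (h-diag ∘ Fin.suc)))
  where
  open ≡-Reasoning
  h′ : Fin n → Fin n → ℕ
  h′ x y = h (Fin.suc x) (Fin.suc y)
  a : ℕ
  a = sum (h Fin.zero ∘ Fin.suc)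
  regroup : sum (λ x → sum (h x)) ≡ (a + a) + sum (λ x → sum (h′ x))
  regroup = begin
    h Fin.zero Fin.zero + a + sum (λ x → h (Fin.suc x) Fin.zero + sum (h′ x))
      ≡⟨ cong₂ (λ d s → d + a + s) (h-diag Fin.zero) (∑-distrib-+ (λ x → h (Fin.suc x) Fin.zero) _) ⟩
    a + (sum (λ x → h (Fin.suc x) Fin.zero) + sum (λ x → sum (h′ x)))
      ≡⟨ cong (λ s → a + (s + sum (λ x → sum (h′ x)))) (sum-cong-≗ (λ x → h-sym (Fin.suc x) Fin.zero)) ⟩
    a + (a + sum (λ x → sum (h′ x)))
      ≡⟨ +-assoc a a _ ⟨
    a + a + sum (λ x → sum (h′ x)) ∎

count-across-cut : ∀ {n} (a : Fin n → Fin n → Bool) → (∀ x y → a x y ≡ a y x) → (P : Fin n → Bool) →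
                   sumOver P (λ x → count (λ y → a x y ∧ not (P y))) ≡
                   sumOver (not ∘ P) (λ y → count (λ x → a y x ∧ P x))
count-across-cut {n} a a-sym P = trans (sum-cong-≗ rows) (trans (∑-comm crossing) (sum-cong-≗ columns))
  where
  crossing : Fin n → Fin n → ℕ
  crossing x y = 𝟙 (P x ∧ (a x y ∧ not (P y)))
  rows : ∀ x → (if P x then count (λ y → a x y ∧ not (P y)) else 0) ≡ sum (crossing x)
  rows x with P x
  ... | true  = refl
  ... | false = sym (sum-zero {f = λ y → 𝟙 (false ∧ (a x y ∧ not (P y)))} (λ _ → refl))
  columns : ∀ y → sum (λ x → crossing x y) ≡ (if not (P y) then count (λ x → a y x ∧ P x) else 0)
  columns y with P y
  ... | true  = sum-zero (λ x → cong 𝟙 (trans (cong (P x ∧_) (∧-zeroʳ (a x y))) (∧-zeroʳ (P x))))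
  ... | false = sum-cong-≗ (λ x → cong 𝟙 (trans (cong (P x ∧_) (trans (∧-identityʳ (a x y)) (a-sym x y)))
                                                  (∧-comm (P x) (a y x))))

-- The matching M⁺

partner-involutive : ∀ m → partner (partner m) ≡ m
partner-involutive zero          = refl
partner-involutive (suc zero)    = refl
partner-involutive (suc (suc m)) = cong (suc ∘ suc) (partner-involutive m)

partner-≢ : ∀ m → partner m ≢ m
partner-≢ (suc (suc m)) e = partner-≢ m (suc-injective (suc-injective e))

partner≤suc : ∀ m → partner m ≤ suc m
partner≤suc zero          = s≤s z≤n
partner≤suc (suc zero)    = z≤n
partner≤suc (suc (suc m)) = s≤s (s≤s (partner≤suc m))

≤suc-partner : ∀ m → m ≤ suc (partner m)
≤suc-partner zero          = z≤n
≤suc-partner (suc zero)    = s≤s z≤n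
≤suc-partner (suc (suc m)) = s≤s (s≤s (≤suc-partner m))

≤-partner : ∀ {k m} → k < m → k ≤ partner m
≤-partner {k} {m} k<m = ≤-pred (≤-trans k<m (≤suc-partner m))

partner-even : ∀ m → isEven m ≡ true → partner m ≡ suc m
partner-even zero          _ = refl
partner-even (suc (suc m)) e = cong (suc ∘ suc) (partner-even m e)

partner-odd : ∀ m → isEven m ≡ false → suc (partner m) ≡ m
partner-odd (suc zero)    _ = refl
partner-odd (suc (suc m)) e = cong (suc ∘ suc) (partner-odd m e)

partner-< : ∀ {m n} → 2 ∣ n → m < n → partner m < n
partner-< (divides q refl) = go q _
  where
  go : ∀ q m → m < q * 2 → partner m < q * 2
  go (suc q) zero          _                = s≤s (s≤s z≤n)
  go (suc q) (suc zero)    _                = z<s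
  go (suc q) (suc (suc m)) (s≤s (s≤s m<n)) = s≤s (s≤s (go q m m<n))

isEven-suc : ∀ m → isEven (suc m) ≡ not (isEven m)
isEven-suc zero          = refl
isEven-suc (suc zero)    = refl
isEven-suc (suc (suc m)) = isEven-suc m

isEven⇒2∣ : ∀ m → isEven m ≡ true → 2 ∣ m
isEven⇒2∣ zero          _ = divides 0 refl
isEven⇒2∣ (suc (suc m)) e with divides q eq ← isEven⇒2∣ m e = divides (suc q) (cong (suc ∘ suc) eq)

-- Degrees and single-edge edits

deg≡count : ∀ {n} (G : SimpleGraph n) x → deg G x ≡ count (adj G x)
deg≡count G x = list-sum-allFin (𝟙 ∘ adj G x)

deg-cong : ∀ {n} (G G′ : SimpleGraph n) x → (∀ y → adj G x y ≡ adj G′ x y) → deg G x ≡ deg G′ x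
deg-cong G G′ x same = begin
  deg G x            ≡⟨ deg≡count G x ⟩
  count (adj G x)    ≡⟨ sum-cong-≗ (cong 𝟙 ∘ same) ⟩
  count (adj G′ x)   ≡⟨ deg≡count G′ x ⟨
  deg G′ x           ∎
  where open ≡-Reasoning

deg-change : ∀ {n} (G G′ : SimpleGraph n) x w → (∀ y → y ≢ w → adj G′ x y ≡ adj G x y) →
             deg G′ x + 𝟙 (adj G x w) ≡ deg G x + 𝟙 (adj G′ x w)
deg-change G G′ x w agree = begin
  deg G′ x + 𝟙 (adj G x w)          ≡⟨ cong (_+ 𝟙 (adj G x w)) (deg≡count G′ x) ⟩
  count (adj G′ x) + 𝟙 (adj G x w)  ≡⟨ count-change (adj G′ x) (adj G x) w agree ⟩
  count (adj G x) + 𝟙 (adj G′ x w)  ≡⟨ cong (_+ 𝟙 (adj G′ x w)) (deg≡count G x) ⟨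
  deg G x + 𝟙 (adj G′ x w)          ∎
  where open ≡-Reasoning

ends : ∀ {n} → Fin n → Fin n → Fin n → ℕ
ends u v x = 𝟙 (x == u) + 𝟙 (x == v)

ends-left : ∀ {n} {u v : Fin n} → u ≢ v → ends u v u ≡ 1
ends-left {u = u} u≢v rewrite ==-refl u | ==-≢ u≢v = refl

ends-right : ∀ {n} {u v : Fin n} → u ≢ v → ends u v v ≡ 1
ends-right {v = v} u≢v rewrite ==-refl v | ==-≢ (u≢v ∘ sym) = refl

ends-outside : ∀ {n} {u v x : Fin n} → x ≢ u → x ≢ v → ends u v x ≡ 0
ends-outside x≢u x≢v rewrite ==-≢ x≢u | ==-≢ x≢v = refl

module _ {n} (G : SimpleGraph n) where

  adj-symᵗ : ∀ {x y} → adj G x y ≡ true → adj G y x ≡ true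
  adj-symᵗ {x} {y} = trans (SimpleGraph.sym G y x)

  adj-symᶠ : ∀ {x y} → adj G x y ≡ false → adj G y x ≡ false
  adj-symᶠ {x} {y} = trans (SimpleGraph.sym G y x)

  adj⇒≢ : ∀ {x y} → adj G x y ≡ true → x ≢ y
  adj⇒≢ {x} e refl = contradiction (trans (sym e) (irrfl G x)) λ ()

  adj-separates : ∀ {a x y} → adj G a x ≡ true → adj G a y ≡ false → x ≢ y
  adj-separates e f refl = contradiction (trans (sym e) f) λ ()

  IsEdge : Fin n → Fin n → Fin n → Fin n → Bool
  IsEdge u v x y = (x == u ∧ y == v) ∨ (x == v ∧ y == u)

  setEdge : (u v : Fin n) (b : Bool) → (b ≡ true → u ≢ v) → SimpleGraph n
  setEdge u v b ok = record
    { adj   = λ x y → if IsEdge u v x y then b else adj G x y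
    ; sym   = λ x y → symmetric x y
    ; irrfl = irreflexive b ok
    }
    where
    symmetric : ∀ x y → (if IsEdge u v x y then b else adj G x y) ≡ (if IsEdge u v y x then b else adj G y x)
    symmetric x y rewrite ∨-comm (x == u ∧ y == v) (x == v ∧ y == u)
                        | ∧-comm (x == v) (y == u) | ∧-comm (x == u) (y == v)
                        with IsEdge u v y x
    ... | true  = refl
    ... | false = SimpleGraph.sym G x y
    irreflexive : ∀ b → (b ≡ true → u ≢ v) → ∀ x → (if IsEdge u v x x then b else adj G x x) ≡ false
    irreflexive false _  x with IsEdge u v x x
    ... | true  = refl
    ... | false = irrfl G x
    irreflexive true  ok x with x ≟ᶠ u | x ≟ᶠ v
    ... | yes refl | yes refl = contradiction refl (ok refl)
    ... | yes refl | no  _    = irrfl G x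
    ... | no  _    | yes refl = irrfl G x
    ... | no  _    | no  _    = irrfl G x

  addEdge : (u v : Fin n) → u ≢ v → SimpleGraph n
  addEdge u v u≢v = setEdge u v true (λ _ → u≢v)

  removeEdge : (u v : Fin n) → SimpleGraph n
  removeEdge u v = setEdge u v false λ ()

  module _ {u v : Fin n} {b : Bool} {ok : b ≡ true → u ≢ v} where

    adj-setEdge : adj (setEdge u v b ok) u v ≡ b
    adj-setEdge rewrite ==-refl u | ==-refl v = refl

    adj-setEdge′ : adj (setEdge u v b ok) v u ≡ b
    adj-setEdge′ = trans (SimpleGraph.sym (setEdge u v b ok) v u) adj-setEdge

    adj-setEdge-other : ∀ {x y} → ¬ (x ≡ u × y ≡ v) → ¬ (x ≡ v × y ≡ u) → adj (setEdge u v b ok) x y ≡ adj G x y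
    adj-setEdge-other {x} {y} ≢uv ≢vu with x ≟ᶠ u | y ≟ᶠ v | x ≟ᶠ v | y ≟ᶠ u
    ... | yes x≡u | yes y≡v | _        | _        = contradiction (x≡u , y≡v) ≢uv
    ... | _       | _       | yes x≡v  | yes y≡u  = contradiction (x≡v , y≡u) ≢vu
    ... | no  _   | _       | no  _    | _        = refl
    ... | no  _   | _       | yes _    | no  _    = refl
    ... | yes _   | no  _   | no  _    | _        = refl
    ... | yes _   | no  _   | yes _    | no  _    = refl

    deg-setEdge : u ≢ v → ∀ x → deg (setEdge u v b ok) x + ends u v x * 𝟙 (adj G u v) ≡ deg G x + ends u v x * 𝟙 b
    deg-setEdge u≢v x = by-cases (x ≟ᶠ u) (x ≟ᶠ v)
      where
      open ≡-Reasoning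
      G′ : SimpleGraph n
      G′ = setEdge u v b ok
      by-cases : Dec (x ≡ u) → Dec (x ≡ v) → deg G′ x + ends u v x * 𝟙 (adj G u v) ≡ deg G x + ends u v x * 𝟙 b
      by-cases (yes refl) (yes refl) = contradiction refl u≢v
      by-cases (yes refl) (no x≢v) = begin
        deg G′ x + ends x v x * 𝟙 (adj G x v)
          ≡⟨ cong (λ e → deg G′ x + e * 𝟙 (adj G x v)) (ends-left u≢v) ⟩
        deg G′ x + 1 * 𝟙 (adj G x v)
          ≡⟨ cong (deg G′ x +_) (*-identityˡ _) ⟩
        deg G′ x + 𝟙 (adj G x v)
          ≡⟨ deg-change G G′ x v (λ y y≢v → adj-setEdge-other (y≢v ∘ proj₂) (x≢v ∘ proj₁)) ⟩
        deg G x + 𝟙 (adj G′ x v)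
          ≡⟨ cong (λ c → deg G x + 𝟙 c) adj-setEdge ⟩
        deg G x + 𝟙 b
          ≡⟨ cong (deg G x +_) (*-identityˡ _) ⟨
        deg G x + 1 * 𝟙 b
          ≡⟨ cong (λ e → deg G x + e * 𝟙 b) (ends-left u≢v) ⟨
        deg G x + ends x v x * 𝟙 b             ∎
      by-cases (no x≢u) (yes refl) = begin
        deg G′ x + ends u x x * 𝟙 (adj G u x)
          ≡⟨ cong (λ e → deg G′ x + e * 𝟙 (adj G u x)) (ends-right u≢v) ⟩
        deg G′ x + 1 * 𝟙 (adj G u x)
          ≡⟨ cong (deg G′ x +_) (trans (*-identityˡ _) (cong 𝟙 (SimpleGraph.sym G u x))) ⟩
        deg G′ x + 𝟙 (adj G x u)
          ≡⟨ deg-change G G′ x u (λ y y≢u → adj-setEdge-other (x≢u ∘ proj₁) (y≢u ∘ proj₂)) ⟩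
        deg G x + 𝟙 (adj G′ x u)
          ≡⟨ cong (λ c → deg G x + 𝟙 c) adj-setEdge′ ⟩
        deg G x + 𝟙 b
          ≡⟨ cong (deg G x +_) (*-identityˡ _) ⟨
        deg G x + 1 * 𝟙 b
          ≡⟨ cong (λ e → deg G x + e * 𝟙 b) (ends-right u≢v) ⟨
        deg G x + ends u x x * 𝟙 b             ∎
      by-cases (no x≢u) (no x≢v) = begin
        deg G′ x + ends u v x * 𝟙 (adj G u v)
          ≡⟨ cong (λ e → deg G′ x + e * 𝟙 (adj G u v)) (ends-outside x≢u x≢v) ⟩
        deg G′ x + 0
          ≡⟨ cong (_+ 0) (deg-cong G′ G x λ y → adj-setEdge-other (x≢u ∘ proj₁) (x≢v ∘ proj₁)) ⟩
        deg G x + 0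
          ≡⟨ cong (λ e → deg G x + e * 𝟙 b) (ends-outside x≢u x≢v) ⟨
        deg G x + ends u v x * 𝟙 b             ∎

  adj-addEdge-other : ∀ {u v x y} {u≢v : u ≢ v} → ¬ (x ≡ u × y ≡ v) → ¬ (x ≡ v × y ≡ u) →
                      adj (addEdge u v u≢v) x y ≡ adj G x y
  adj-addEdge-other {u≢v = u≢v} = adj-setEdge-other {ok = λ _ → u≢v}

  adj-removeEdge-other : ∀ {u v x y} → ¬ (x ≡ u × y ≡ v) → ¬ (x ≡ v × y ≡ u) → adj (removeEdge u v) x y ≡ adj G x y
  adj-removeEdge-other = adj-setEdge-other {ok = λ ()}

  adj-addEdge-mono : ∀ {u v x y} {u≢v : u ≢ v} → adj G x y ≡ true → adj (addEdge u v u≢v) x y ≡ true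
  adj-addEdge-mono {u} {v} {x} {y} xy∈G with IsEdge u v x y
  ... | true  = refl
  ... | false = xy∈G

  deg-addEdge : ∀ {u v} (u≢v : u ≢ v) → adj G u v ≡ false → ∀ x → deg (addEdge u v u≢v) x ≡ deg G x + ends u v x
  deg-addEdge {u} {v} u≢v uv∉G x = begin
    deg (addEdge u v u≢v) x                      ≡⟨ +-identityʳ _ ⟨
    deg (addEdge u v u≢v) x + 0                  ≡⟨ cong (deg (addEdge u v u≢v) x +_) (*-zeroʳ (ends u v x)) ⟨
    deg (addEdge u v u≢v) x + ends u v x * 0     ≡⟨ cong (λ c → deg (addEdge u v u≢v) x + ends u v x * 𝟙 c) uv∉G ⟨
    deg (addEdge u v u≢v) x + ends u v x * 𝟙 (adj G u v) ≡⟨ deg-setEdge {ok = λ _ → u≢v} u≢v x ⟩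
    deg G x + ends u v x * 1                     ≡⟨ cong (deg G x +_) (*-identityʳ _) ⟩
    deg G x + ends u v x                         ∎
    where open ≡-Reasoning

  deg-removeEdge : ∀ {u v} → adj G u v ≡ true → ∀ x → deg (removeEdge u v) x + ends u v x ≡ deg G x
  deg-removeEdge {u} {v} uv∈G x = begin
    deg (removeEdge u v) x + ends u v x          ≡⟨ cong (deg (removeEdge u v) x +_) (*-identityʳ _) ⟨
    deg (removeEdge u v) x + ends u v x * 1      ≡⟨ cong (λ c → deg (removeEdge u v) x + ends u v x * 𝟙 c) uv∈G ⟨
    deg (removeEdge u v) x + ends u v x * 𝟙 (adj G u v) ≡⟨ deg-setEdge {ok = λ ()} (adj⇒≢ uv∈G) x ⟩
    deg G x + ends u v x * 0                     ≡⟨ cong (deg G x +_) (*-zeroʳ (ends u v x)) ⟩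
    deg G x + 0                                  ≡⟨ +-identityʳ _ ⟩
    deg G x                                      ∎
    where open ≡-Reasoning

-- Necessity

below : ∀ {n} → ℕ → Fin n → Bool
below k x = toℕ x <ᵇ k

-- The right-hand side of the k-th inequality, written uniformly in k. Only for odd k is a vertex
-- outside the first k (namely vertex k + 1) matched by M⁺ into them, which is where the two cases
-- of `bound` come from.
capacity : ∀ {n} → (Fin n → ℕ) → ℕ → Fin n → ℕ
capacity d k y = (d y ∸ 𝟙 (not (partner (toℕ y) <ᵇ k))) ⊓ k

prefixBound : ∀ {n} → (Fin n → ℕ) → ℕ → ℕ
prefixBound d k = k * (k ∸ 1) + sumOver (not ∘ below k) (capacity d k)

sum-deg-even : ∀ {n} (G : SimpleGraph n) → 2 ∣ sum (deg G)
sum-deg-even G = subst (2 ∣_) (sym (sum-cong-≗ (deg≡count G)))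
  (sum-symmetric-even (λ x y → 𝟙 (adj G x y)) (λ x y → cong 𝟙 (SimpleGraph.sym G x y)) (cong 𝟙 ∘ irrfl G))

ContainsM⁺⇒2∣n : ∀ {n} (G : SimpleGraph n) → ContainsM⁺ G → 2 ∣ n
ContainsM⁺⇒2∣n {zero}  G M⁺⊆G = divides 0 refl
ContainsM⁺⇒2∣n {suc m} G M⁺⊆G with isEven m in even-m
... | false = isEven⇒2∣ (suc m) (trans (isEven-suc m) (cong not even-m))
... | true  = contradiction (toℕ<n j) (<-irrefl (begin
  toℕ j                 ≡⟨ j-partner ⟩
  partner (toℕ last)    ≡⟨ cong partner (toℕ-fromℕ< (n<1+n m)) ⟩
  partner m             ≡⟨ partner-even m even-m ⟩
  suc m                 ∎))
  where
  open ≡-Reasoning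
  last : Fin (suc m)
  last = fromℕ< (n<1+n m)
  j : Fin (suc m)
  j = proj₁ (M⁺⊆G last)
  j-partner : toℕ j ≡ partner (toℕ last)
  j-partner = proj₁ (proj₂ (M⁺⊆G last))

deg-split : ∀ {n} (G : SimpleGraph n) (P : Fin n → Bool) x →
            deg G x ≡ count (λ y → adj G x y ∧ P y) + count (λ y → adj G x y ∧ not (P y))
deg-split G P x = trans (deg≡count G x) (count-split (adj G x) P)

neighbours-in-prefix : ∀ {n} (G : SimpleGraph n) {P : Fin n → Bool} x → P x ≡ true →
                       1 + count (λ y → adj G x y ∧ P y) ≤ count P
neighbours-in-prefix G {P} x Px = count-mono-< x (λ y → ∧-trueʳ {adj G x y}) Px (cong (_∧ P x) (irrfl G x))

prefix-degree-split : ∀ {n} (G : SimpleGraph n) (P : Fin n → Bool) →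
                      sumOver P (deg G) ≡ sumOver P (λ x → count (λ y → adj G x y ∧ P y)) +
                                          sumOver (not ∘ P) (λ y → count (λ x → adj G y x ∧ P x))
prefix-degree-split {n} G P = begin
  sumOver P (deg G)
    ≡⟨ sumOver-cong P (λ x _ → deg-split G P x) ⟩
  sumOver P (λ x → inside x + outside x)
    ≡⟨ sumOver-+ P inside outside ⟩
  sumOver P inside + sumOver P outside
    ≡⟨ cong (sumOver P inside +_) (count-across-cut (adj G) (SimpleGraph.sym G) P) ⟩
  sumOver P inside + sumOver (not ∘ P) (λ y → count (λ x → adj G y x ∧ P x)) ∎
  where
  open ≡-Reasoning
  inside outside : Fin n → ℕ
  inside x = count (λ y → adj G x y ∧ P y)
  outside x = count (λ y → adj G x y ∧ not (P y))

prefixBound-cong : ∀ {n} {d d′ : Fin n → ℕ} → (∀ x → d x ≡ d′ x) → ∀ k → prefixBound d k ≡ prefixBound d′ k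
prefixBound-cong d≡d′ k =
  cong (k * (k ∸ 1) +_) (sumOver-cong _ (λ x _ → cong (λ e → (e ∸ 𝟙 (not (partner (toℕ x) <ᵇ k))) ⊓ k) (d≡d′ x)))

prefix-inequality : ∀ {n} (G : SimpleGraph n) → ContainsM⁺ G → ∀ k → k ≤ n →
                    sumOver (below k) (deg G) ≤ prefixBound (deg G) k
prefix-inequality {n} G M⁺⊆G k k≤n = begin
  sumOver P (deg G)                                     ≡⟨ prefix-degree-split G P ⟩
  sumOver P inside + sumOver (not ∘ P) inside
    ≤⟨ +-mono-≤ (sumOver-mono-≤ P inside≤) (sumOver-mono-≤ (not ∘ P) crossing≤capacity) ⟩
  sumOver P (λ _ → k ∸ 1) + sumOver (not ∘ P) (capacity (deg G) k)
    ≡⟨ cong (_+ sumOver (not ∘ P) (capacity (deg G) k))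
            (trans (sumOver-const P (k ∸ 1)) (cong (_* (k ∸ 1)) (count-below k k≤n))) ⟩
  prefixBound (deg G) k                                 ∎
  where
  open ≤-Reasoning
  P : Fin n → Bool
  P = below k
  inside outside : Fin n → ℕ
  inside x = count (λ y → adj G x y ∧ P y)
  outside x = count (λ y → adj G x y ∧ not (P y))
  inside≤ : ∀ x → P x ≡ true → inside x ≤ k ∸ 1
  inside≤ x Px = m+n≤o⇒m≤o∸n (inside x) (begin
    inside x + 1  ≡⟨ +-comm (inside x) 1 ⟩
    1 + inside x  ≤⟨ neighbours-in-prefix G x Px ⟩
    count P       ≡⟨ count-below k k≤n ⟩
    k             ∎)
  crossing≤capacity : ∀ y → not (P y) ≡ true → inside y ≤ capacity (deg G) k y
  crossing≤capacity y _ = ⊓-glb (m+n≤o⇒m≤o∸n (inside y) (begin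
      inside y + 𝟙 (not (partner (toℕ y) <ᵇ k)) ≡⟨ cong (λ b → inside y + 𝟙 b) partner-outside ⟩
      inside y + 𝟙 (adj G y j ∧ not (P j))     ≤⟨ +-monoʳ-≤ (inside y) (𝟙≤count _ j) ⟩
      inside y + outside y                    ≡⟨ deg-split G P y ⟨
      deg G y                                 ∎))
    (≤-trans (count-∧-≤ʳ (adj G y) P) (≤-reflexive (count-below k k≤n)))
    where
    j : Fin n
    j = proj₁ (M⁺⊆G y)
    partner-outside : not (partner (toℕ y) <ᵇ k) ≡ (adj G y j ∧ not (P j))
    partner-outside rewrite proj₂ (proj₂ (M⁺⊆G y)) | proj₁ (proj₂ (M⁺⊆G y)) = refl

-- Sufficiency

record Ledger {n} (G G′ : SimpleGraph n) (lost gained : Fin n → ℕ) : Set where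
  constructor mkLedger
  field balance : ∀ x → deg G′ x + lost x ≡ deg G x + gained x
open Ledger

ledger-refl : ∀ {n} (G : SimpleGraph n) → Ledger G G (λ _ → 0) (λ _ → 0)
ledger-refl G = mkLedger λ x → refl

ledger-addEdge : ∀ {n} {G G′ : SimpleGraph n} {lost gained} → Ledger G G′ lost gained →
                 ∀ {u v} (u≢v : u ≢ v) → adj G′ u v ≡ false →
                 Ledger G (addEdge G′ u v u≢v) lost (λ x → gained x + ends u v x)
ledger-addEdge {G = G} {G′} {lost} {gained} ledger {u} {v} u≢v uv∉G′ = mkLedger λ x → begin
  deg (addEdge G′ u v u≢v) x + lost x  ≡⟨ cong (_+ lost x) (deg-addEdge G′ u≢v uv∉G′ x) ⟩
  deg G′ x + ends u v x + lost x       ≡⟨ +-assoc (deg G′ x) _ _ ⟩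
  deg G′ x + (ends u v x + lost x)     ≡⟨ cong (deg G′ x +_) (+-comm (ends u v x) (lost x)) ⟩
  deg G′ x + (lost x + ends u v x)     ≡⟨ +-assoc (deg G′ x) _ _ ⟨
  deg G′ x + lost x + ends u v x       ≡⟨ cong (_+ ends u v x) (balance ledger x) ⟩
  deg G x + gained x + ends u v x      ≡⟨ +-assoc (deg G x) _ _ ⟩
  deg G x + (gained x + ends u v x)    ∎
  where open ≡-Reasoning

ledger-removeEdge : ∀ {n} {G G′ : SimpleGraph n} {lost gained} → Ledger G G′ lost gained →
                    ∀ {u v} → adj G′ u v ≡ true →
                    Ledger G (removeEdge G′ u v) (λ x → lost x + ends u v x) gained
ledger-removeEdge {G = G} {G′} {lost} {gained} ledger {u} {v} uv∈G′ = mkLedger λ x → begin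
  deg (removeEdge G′ u v) x + (lost x + ends u v x)  ≡⟨ cong (deg (removeEdge G′ u v) x +_) (+-comm (lost x) _) ⟩
  deg (removeEdge G′ u v) x + (ends u v x + lost x)  ≡⟨ +-assoc (deg (removeEdge G′ u v) x) _ _ ⟨
  deg (removeEdge G′ u v) x + ends u v x + lost x    ≡⟨ cong (_+ lost x) (deg-removeEdge G′ uv∈G′ x) ⟩
  deg G′ x + lost x                                  ≡⟨ balance ledger x ⟩
  deg G x + gained x                                 ∎
  where open ≡-Reasoning

module Sufficiency {n} (d : Fin n → ℕ) (2∣n : 2 ∣ n) (d-noninc : NonIncreasing d) (2∣∑d : 2 ∣ sum d)
  (prefix-ok : ∀ k → 1 ≤ k → k ≤ n → sumOver (below k) d ≤ prefixBound d k) where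

  mate : Fin n → Fin n
  mate x = fromℕ< (partner-< 2∣n (toℕ<n x))

  toℕ-mate : ∀ x → toℕ (mate x) ≡ partner (toℕ x)
  toℕ-mate x = toℕ-fromℕ< _

  mate-involutive : ∀ x → mate (mate x) ≡ x
  mate-involutive x = toℕ-injective (begin
    toℕ (mate (mate x))       ≡⟨ toℕ-mate (mate x) ⟩
    partner (toℕ (mate x))    ≡⟨ cong partner (toℕ-mate x) ⟩
    partner (partner (toℕ x)) ≡⟨ partner-involutive (toℕ x) ⟩
    toℕ x                     ∎)
    where open ≡-Reasoning

  mate-≢ : ∀ x → mate x ≢ x
  mate-≢ x e = partner-≢ (toℕ x) (trans (sym (toℕ-mate x)) (cong toℕ e))

  mate-injective : ∀ {x y} → mate x ≡ mate y → x ≡ y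
  mate-injective {x} {y} e = trans (sym (mate-involutive x)) (trans (cong mate e) (mate-involutive y))

  ContainsMate : SimpleGraph n → Set
  ContainsMate G = ∀ x → adj G x (mate x) ≡ true

  containsMate-addEdge : ∀ G → ContainsMate G → ∀ {u v} (u≢v : u ≢ v) → ContainsMate (addEdge G u v u≢v)
  containsMate-addEdge G M⊆G {u} {v} u≢v x with IsEdge G u v x (mate x)
  ... | true  = refl
  ... | false = M⊆G x

  containsMate-removeEdge : ∀ G → ContainsMate G → ∀ {u v} → v ≢ mate u → ContainsMate (removeEdge G u v)
  containsMate-removeEdge G M⊆G {u} {v} v≢mate-u x = trans (adj-setEdge-other G {ok = λ ()} not-uv not-vu) (M⊆G x)
    where
    not-uv : ¬ (x ≡ u × mate x ≡ v)
    not-uv (refl , refl) = v≢mate-u refl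
    not-vu : ¬ (x ≡ v × mate x ≡ u)
    not-vu (refl , e) = v≢mate-u (trans (sym (mate-involutive x)) (cong mate e))

  matching : SimpleGraph n
  matching = record { adj = λ x y → y == mate x ; sym = symmetric ; irrfl = λ x → ==-≢ (mate-≢ x ∘ sym) }
    where
    symmetric : ∀ x y → (y == mate x) ≡ (x == mate y)
    symmetric x y with y ≟ᶠ mate x | x ≟ᶠ mate y
    ... | yes _    | yes _    = refl
    ... | no  _    | no  _    = refl
    ... | yes refl | no  x≢   = contradiction (sym (mate-involutive x)) x≢
    ... | no  y≢   | yes refl = contradiction (sym (mate-involutive y)) y≢

  deg-matching : ∀ x → deg matching x ≡ 1
  deg-matching x = trans (deg≡count matching x) (trans (count-split-at _ (mate x)) (cong₂ _+_ (cong 𝟙 (==-refl (mate x))) rest≡0))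
    where
    rest≡0 : count (λ y → (y == mate x) ∧ not (y == mate x)) ≡ 0
    rest≡0 = sum-zero λ y → cong 𝟙 (∧-inverseʳ (y == mate x))

  record Edit (G : SimpleGraph n) (lost gained : Fin n → ℕ) : Set where
    constructor edit
    field
      result  : SimpleGraph n
      ledger  : Ledger G result lost gained
      mates⊆  : ContainsMate result
  open Edit

  unedited : ∀ G → ContainsMate G → Edit G (λ _ → 0) (λ _ → 0)
  unedited G M⊆G = edit G (ledger-refl G) M⊆G

  edit-addEdge : ∀ {G lost gained} (e : Edit G lost gained) {u v} (u≢v : u ≢ v) → adj (result e) u v ≡ false →
                 Edit G lost (λ x → gained x + ends u v x)
  edit-addEdge (edit G′ ledger M⊆G′) u≢v uv∉G′ =
    edit (addEdge G′ _ _ u≢v) (ledger-addEdge ledger u≢v uv∉G′) (containsMate-addEdge G′ M⊆G′ u≢v)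

  edit-removeEdge : ∀ {G lost gained} (e : Edit G lost gained) {u v} → adj (result e) u v ≡ true → v ≢ mate u →
                    Edit G (λ x → lost x + ends u v x) gained
  edit-removeEdge (edit G′ ledger M⊆G′) uv∈G′ v≢mate-u =
    edit (removeEdge G′ _ _) (ledger-removeEdge ledger uv∈G′) (containsMate-removeEdge G′ M⊆G′ v≢mate-u)

  record Invariant (r : ℕ) (G : SimpleGraph n) : Set where
    field
      mates     : ContainsMate G
      deg≤d     : ∀ x → deg G x ≤ d x
      saturated : ∀ x → toℕ x < r → deg G x ≡ d x
  open Invariant

  module AtVertex (v : Fin n) where

    r : ℕ
    r = toℕ v

    earlier : Fin n → Bool
    earlier = below r

    below⇒≢v : ∀ {x} → toℕ x < r → x ≢ v
    below⇒≢v x<r refl = <-irrefl refl x<r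

    above⇒≢v : ∀ {x} → r < toℕ x → x ≢ v
    above⇒≢v r<x refl = <-irrefl refl r<x

    below≢above : ∀ {x y : Fin n} → toℕ x < r → r < toℕ y → x ≢ y
    below≢above x<r r<y refl = <-asym x<r r<y

    mate-of-below : ∀ {x w} → toℕ x < r → r < toℕ w → w ≢ mate x
    mate-of-below {x} x<r r<w refl = <⇒≱ r<w (begin
      toℕ (mate x)       ≡⟨ toℕ-mate x ⟩
      partner (toℕ x)    ≤⟨ partner≤suc (toℕ x) ⟩
      suc (toℕ x)        ≤⟨ x<r ⟩
      r                  ∎)
      where open ≤-Reasoning

    mate-of-above : ∀ {w x} → r < toℕ w → toℕ x < r → x ≢ mate w
    mate-of-above {w} r<w x<r refl = mate-of-below x<r (subst (λ y → r < toℕ y) (sym (mate-involutive w)) r<w) refl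

    density : SimpleGraph n → ℕ
    density G = sumOver earlier (λ x → count (λ y → adj G x y ∧ earlier y))

    density≤r*r : ∀ G → density G ≤ r * r
    density≤r*r G = begin
      density G                     ≤⟨ sumOver-mono-≤ earlier (λ x _ → count-∧-≤ʳ (adj G x) earlier) ⟩
      sumOver earlier (λ _ → count earlier) ≡⟨ sumOver-const earlier (count earlier) ⟩
      count earlier * count earlier ≡⟨ cong (λ c → c * c) (count-below r (<⇒≤ (toℕ<n v))) ⟩
      r * r                         ∎
      where open ≤-Reasoning

    measure : SimpleGraph n → ℕ × ℕ
    measure G = d v ∸ deg G v , r * r ∸ density G

    _⊏_ : SimpleGraph n → SimpleGraph n → Set
    _⊏_ = ×-Lex _≡_ _<_ _<_ on measure

    ⊏-wellFounded : WellFounded _⊏_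
    ⊏-wellFounded = On.wellFounded measure (×-wellFounded <-wellFounded <-wellFounded)

    Improvement : SimpleGraph n → Set
    Improvement G = Σ[ G′ ∈ SimpleGraph n ] Invariant r G′ × G′ ⊏ G

    module Moves (G : SimpleGraph n) (I : Invariant r G) where

      Bounded : (lost gained : Fin n → ℕ) → Set
      Bounded lost gained = ∀ x → deg G x + gained x ≤ d x + lost x

      Balanced : (lost gained : Fin n → ℕ) → Set
      Balanced lost gained = ∀ x → toℕ x < r → gained x ≡ lost x

      finish : ∀ {lost gained} (e : Edit G lost gained) → Bounded lost gained → Balanced lost gained →
               Invariant r (result e)
      finish {lost} (edit G′ ledger M⊆G′) bounded balanced = record
        { mates     = M⊆G′
        ; deg≤d     = λ x → +-cancelʳ-≤ (lost x) _ _ (≤-trans (≤-reflexive (balance ledger x)) (bounded x))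
        ; saturated = λ x x<r → +-cancelʳ-≡ (lost x) _ _
                        (trans (balance ledger x) (cong₂ _+_ (saturated I x x<r) (balanced x x<r)))
        }

      raise : ∀ {lost gained} (e : Edit G lost gained) → Bounded lost gained → Balanced lost gained →
              lost v < gained v → Improvement G
      raise {lost} {gained} e bounded balanced lost<gained =
        result e , I′ , inj₁ (∸-monoʳ-< deg-grows (deg≤d I′ v))
        where
        I′ : Invariant r (result e)
        I′ = finish e bounded balanced
        deg-grows : deg G v < deg (result e) v
        deg-grows = +-cancelʳ-< (lost v) _ _ (begin-strict
          deg G v + lost v          <⟨ +-monoʳ-< (deg G v) lost<gained ⟩
          deg G v + gained v        ≡⟨ balance (ledger e) v ⟨
          deg (result e) v + lost v ∎)
          where open ≤-Reasoning

      densify : ∀ {lost gained} (e : Edit G lost gained) → Bounded lost gained → Balanced lost gained →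
                gained v ≡ lost v → density G < density (result e) → Improvement G
      densify {lost} e bounded balanced v-balanced denser =
        result e , finish e bounded balanced , inj₂ (cong (d v ∸_) same-deg , ∸-monoʳ-< denser (density≤r*r (result e)))
        where
        same-deg : deg (result e) v ≡ deg G v
        same-deg = +-cancelʳ-≡ (lost v) _ _ (trans (balance (ledger e) v) (cong (deg G v +_) v-balanced))

      saturated≢deficient : ∀ {x z} → toℕ x < r → deg G z < d z → x ≢ z
      saturated≢deficient {x} x<r z-def refl = <-irrefl (saturated I x x<r) z-def

      bounded-except : ∀ {lost gained : Fin n → ℕ} (z : Fin n) → (∀ x → x ≢ v → x ≢ z → gained x ≤ lost x) →
                       deg G v + gained v ≤ d v + lost v → deg G z + gained z ≤ d z + lost z →
                       Bounded lost gained
      bounded-except z others at-v at-z x with x ≟ᶠ v | x ≟ᶠ z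
      ... | yes refl | _        = at-v
      ... | no  _    | yes refl = at-z
      ... | no  x≢v  | no  x≢z  = +-mono-≤ (deg≤d I x) (others x x≢v x≢z)

      bounded-except-v : ∀ {lost gained : Fin n → ℕ} → (∀ x → x ≢ v → gained x ≤ lost x) →
                         deg G v + gained v ≤ d v + lost v → Bounded lost gained
      bounded-except-v others at-v = bounded-except v (λ x x≢v _ → others x x≢v) at-v at-v

      room : ∀ {x} → deg G x < d x → ∀ k → deg G x + suc k ≤ d x + k
      room {x} x-def k = subst (_≤ d x + k) (sym (+-suc (deg G x) k)) (+-monoˡ-≤ k x-def)

      -- The switches, as removed edges ↦ added edges; a removed edge is never an M⁺-edge:
      --   link ∅ ↦ vz,  pull xw ↦ xv,  insert xu ↦ xv uv,  reroute ab ↦ av bz,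
      --   swap xu vz ↦ xv uv,  exchange iw jw′ ↦ vw ij,  close iwᵢ jwⱼ ↦ ij.
      -- All but `close` raise deg v; `close` keeps it and joins two earlier vertices.
      Link : Fin n → Set
      Link z = z ≢ v × adj G v z ≡ false × deg G z < d z

      link? : ∀ z → Dec (Link z)
      link? z = ¬? (z ≟ᶠ v) ×-dec adj G v z ≟ᵇ false ×-dec deg G z <? d z

      link : deg G v < d v → ∀ z → Link z → Improvement G
      link v-def z (z≢v , vz∉G , z-def) = raise e (bounded-except z others at-v at-z) balanced progress
        where
        v≢z : v ≢ z
        v≢z = z≢v ∘ sym
        e : Edit G (λ _ → 0) (ends v z)
        e = edit-addEdge (unedited G (mates I)) v≢z vz∉G
        others : ∀ x → x ≢ v → x ≢ z → ends v z x ≤ 0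
        others x x≢v x≢z = ≤-reflexive (ends-outside x≢v x≢z)
        at-v : deg G v + ends v z v ≤ d v + 0
        at-v rewrite ends-left v≢z = room v-def 0
        at-z : deg G z + ends v z z ≤ d z + 0
        at-z rewrite ends-right v≢z = room z-def 0
        balanced : Balanced (λ _ → 0) (ends v z)
        balanced x x<r = ends-outside (below⇒≢v x<r) (saturated≢deficient x<r z-def)
        progress : 0 < ends v z v
        progress rewrite ends-left v≢z = z<s

      Pull : Fin n → Fin n → Set
      Pull x w = x ≢ v × adj G x v ≡ false × r < toℕ w × adj G x w ≡ true × w ≢ mate x

      pull? : ∀ x w → Dec (Pull x w)
      pull? x w = ¬? (x ≟ᶠ v) ×-dec adj G x v ≟ᵇ false ×-dec r <? toℕ w ×-dec adj G x w ≟ᵇ true ×-dec ¬? (w ≟ᶠ mate x)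

      pull : deg G v < d v → ∀ x w → Pull x w → Improvement G
      pull v-def x w (x≢v , xv∉G , r<w , xw∈G , w≢mate) = raise e (bounded-except-v others at-v) balanced progress
        where
        w≢v : w ≢ v
        w≢v = above⇒≢v r<w
        x≢w : x ≢ w
        x≢w = adj⇒≢ G xw∈G
        e₁ : Edit G (ends x w) (λ _ → 0)
        e₁ = edit-removeEdge (unedited G (mates I)) xw∈G w≢mate
        xv∉G₁ : adj (result e₁) x v ≡ false
        xv∉G₁ = trans (adj-removeEdge-other G (w≢v ∘ sym ∘ proj₂) (x≢w ∘ proj₁)) xv∉G
        e : Edit G (ends x w) (ends x v)
        e = edit-addEdge e₁ x≢v xv∉G₁
        others : ∀ y → y ≢ v → ends x v y ≤ ends x w y
        others y y≢v rewrite ==-≢ y≢v | +-identityʳ (𝟙 (y == x)) = m≤m+n _ _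
        at-v : deg G v + ends x v v ≤ d v + ends x w v
        at-v rewrite ends-right x≢v | ends-outside (x≢v ∘ sym) (w≢v ∘ sym) = room v-def 0
        balanced : Balanced (ends x w) (ends x v)
        balanced y y<r rewrite ==-≢ (below⇒≢v y<r) | ==-≢ (below≢above y<r r<w) = refl
        progress : ends x w v < ends x v v
        progress rewrite ends-right x≢v | ends-outside (x≢v ∘ sym) (w≢v ∘ sym) = z<s

      Insert : Fin n → Fin n → Set
      Insert x u = x ≢ v × adj G x v ≡ false × adj G x u ≡ true × u ≢ mate x × u ≢ v × adj G u v ≡ false

      insert? : ∀ x u → Dec (Insert x u)
      insert? x u = ¬? (x ≟ᶠ v) ×-dec adj G x v ≟ᵇ false ×-dec adj G x u ≟ᵇ true ×-dec ¬? (u ≟ᶠ mate x) ×-dec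
                    ¬? (u ≟ᶠ v) ×-dec adj G u v ≟ᵇ false

      insert : deg G v + 2 ≤ d v → ∀ x u → Insert x u → Improvement G
      insert v-def₂ x u (x≢v , xv∉G , xu∈G , u≢mate , u≢v , uv∉G) =
        raise e (bounded-except-v others at-v) balanced progress
        where
        x≢u : x ≢ u
        x≢u = adj⇒≢ G xu∈G
        e₁ : Edit G (ends x u) (λ _ → 0)
        e₁ = edit-removeEdge (unedited G (mates I)) xu∈G u≢mate
        xv∉G₁ : adj (result e₁) x v ≡ false
        xv∉G₁ = trans (adj-removeEdge-other G (u≢v ∘ sym ∘ proj₂) (x≢u ∘ proj₁)) xv∉G
        e₂ : Edit G (ends x u) (ends x v)
        e₂ = edit-addEdge e₁ x≢v xv∉G₁
        uv∉G₂ : adj (result e₂) u v ≡ false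
        uv∉G₂ = trans (adj-addEdge-other (result e₁) {u≢v = x≢v} (x≢u ∘ sym ∘ proj₁) (u≢v ∘ proj₁))
                      (trans (adj-removeEdge-other G (x≢u ∘ sym ∘ proj₁) (x≢v ∘ sym ∘ proj₂)) uv∉G)
        e : Edit G (ends x u) (λ y → ends x v y + ends u v y)
        e = edit-addEdge e₂ u≢v uv∉G₂
        others : ∀ y → y ≢ v → ends x v y + ends u v y ≤ ends x u y
        others y y≢v rewrite ==-≢ y≢v | +-identityʳ (𝟙 (y == x)) | +-identityʳ (𝟙 (y == u)) = ≤-refl
        at-v : deg G v + (ends x v v + ends u v v) ≤ d v + ends x u v
        at-v rewrite ends-right x≢v | ends-right u≢v | ends-outside (x≢v ∘ sym) (u≢v ∘ sym) =
          subst (deg G v + 2 ≤_) (sym (+-identityʳ (d v))) v-def₂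
        balanced : Balanced (ends x u) (λ y → ends x v y + ends u v y)
        balanced y y<r rewrite ==-≢ (below⇒≢v y<r) | +-identityʳ (𝟙 (y == x)) | +-identityʳ (𝟙 (y == u)) = refl
        progress : ends x u v < ends x v v + ends u v v
        progress rewrite ends-right x≢v | ends-right u≢v | ends-outside (x≢v ∘ sym) (u≢v ∘ sym) = z<s

      Reroute : Fin n → Fin n → Fin n → Set
      Reroute a b z = adj G a b ≡ true × b ≢ mate a × a ≢ v × adj G a v ≡ false × b ≢ z × adj G b z ≡ false ×
                      deg G z < d z × z ≢ v × b ≢ v

      reroute? : ∀ a b z → Dec (Reroute a b z)
      reroute? a b z = adj G a b ≟ᵇ true ×-dec ¬? (b ≟ᶠ mate a) ×-dec ¬? (a ≟ᶠ v) ×-dec adj G a v ≟ᵇ false ×-dec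
                       ¬? (b ≟ᶠ z) ×-dec adj G b z ≟ᵇ false ×-dec deg G z <? d z ×-dec ¬? (z ≟ᶠ v) ×-dec ¬? (b ≟ᶠ v)

      reroute : deg G v < d v → ∀ a b z → Reroute a b z → Improvement G
      reroute v-def a b z (ab∈G , b≢mate , a≢v , av∉G , b≢z , bz∉G , z-def , z≢v , b≢v) =
        raise e (bounded-except z others at-v at-z) balanced progress
        where
        a≢b : a ≢ b
        a≢b = adj⇒≢ G ab∈G
        a≢z : a ≢ z
        a≢z = adj-separates G (adj-symᵗ G ab∈G) bz∉G
        e₁ : Edit G (ends a b) (λ _ → 0)
        e₁ = edit-removeEdge (unedited G (mates I)) ab∈G b≢mate
        av∉G₁ : adj (result e₁) a v ≡ false
        av∉G₁ = trans (adj-removeEdge-other G (b≢v ∘ sym ∘ proj₂) (a≢b ∘ proj₁)) av∉G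
        e₂ : Edit G (ends a b) (ends a v)
        e₂ = edit-addEdge e₁ a≢v av∉G₁
        bz∉G₂ : adj (result e₂) b z ≡ false
        bz∉G₂ = trans (adj-addEdge-other (result e₁) {u≢v = a≢v} (a≢b ∘ sym ∘ proj₁) (b≢v ∘ proj₁))
                      (trans (adj-removeEdge-other G (a≢b ∘ sym ∘ proj₁) (a≢z ∘ sym ∘ proj₂)) bz∉G)
        e : Edit G (ends a b) (λ y → ends a v y + ends b z y)
        e = edit-addEdge e₂ b≢z bz∉G₂
        others : ∀ y → y ≢ v → y ≢ z → ends a v y + ends b z y ≤ ends a b y
        others y y≢v y≢z rewrite ==-≢ y≢v | ==-≢ y≢z | +-identityʳ (𝟙 (y == a)) | +-identityʳ (𝟙 (y == b)) = ≤-refl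
        at-v : deg G v + (ends a v v + ends b z v) ≤ d v + ends a b v
        at-v rewrite ends-right a≢v | ends-outside (b≢v ∘ sym) (z≢v ∘ sym) | ends-outside (a≢v ∘ sym) (b≢v ∘ sym) =
          room v-def 0
        at-z : deg G z + (ends a v z + ends b z z) ≤ d z + ends a b z
        at-z rewrite ends-right b≢z | ends-outside (a≢z ∘ sym) z≢v | ends-outside (a≢z ∘ sym) (b≢z ∘ sym) =
          room z-def 0
        balanced : Balanced (ends a b) (λ y → ends a v y + ends b z y)
        balanced y y<r rewrite ==-≢ (below⇒≢v y<r) | ==-≢ (saturated≢deficient y<r z-def)
                             | +-identityʳ (𝟙 (y == a)) | +-identityʳ (𝟙 (y == b)) = refl
        progress : ends a b v < ends a v v + ends b z v
        progress rewrite ends-right a≢v | ends-outside (b≢v ∘ sym) (z≢v ∘ sym) | ends-outside (a≢v ∘ sym) (b≢v ∘ sym) = z<s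

      Swap : Fin n → Fin n → Fin n → Set
      Swap x u z = x ≢ v × adj G x v ≡ false × adj G x u ≡ true × u ≢ mate x × u ≢ v × adj G u v ≡ false ×
                   adj G v z ≡ true × z ≢ mate v × deg G z < d z

      swap? : ∀ x u z → Dec (Swap x u z)
      swap? x u z = ¬? (x ≟ᶠ v) ×-dec adj G x v ≟ᵇ false ×-dec adj G x u ≟ᵇ true ×-dec ¬? (u ≟ᶠ mate x) ×-dec
                    ¬? (u ≟ᶠ v) ×-dec adj G u v ≟ᵇ false ×-dec adj G v z ≟ᵇ true ×-dec ¬? (z ≟ᶠ mate v) ×-dec deg G z <? d z

      swap : deg G v < d v → ∀ x u z → Swap x u z → Improvement G
      swap v-def x u z (x≢v , xv∉G , xu∈G , u≢mate , u≢v , uv∉G , vz∈G , z≢mate , z-def) =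
        raise e (bounded-except-v others at-v) balanced progress
        where
        x≢u : x ≢ u
        x≢u = adj⇒≢ G xu∈G
        v≢z : v ≢ z
        v≢z = adj⇒≢ G vz∈G
        z≢x : z ≢ x
        z≢x = adj-separates G vz∈G (adj-symᶠ G xv∉G)
        z≢u : z ≢ u
        z≢u = adj-separates G vz∈G (adj-symᶠ G uv∉G)
        e₁ : Edit G (ends x u) (λ _ → 0)
        e₁ = edit-removeEdge (unedited G (mates I)) xu∈G u≢mate
        vz∈G₁ : adj (result e₁) v z ≡ true
        vz∈G₁ = trans (adj-removeEdge-other G (x≢v ∘ sym ∘ proj₁) (u≢v ∘ sym ∘ proj₁)) vz∈G
        e₂ : Edit G (λ y → ends x u y + ends v z y) (λ _ → 0)
        e₂ = edit-removeEdge e₁ vz∈G₁ z≢mate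
        xv∉G₂ : adj (result e₂) x v ≡ false
        xv∉G₂ = trans (adj-removeEdge-other (result e₁) (x≢v ∘ proj₁) (z≢x ∘ sym ∘ proj₁))
                      (trans (adj-removeEdge-other G (u≢v ∘ sym ∘ proj₂) (x≢u ∘ proj₁)) xv∉G)
        e₃ : Edit G (λ y → ends x u y + ends v z y) (ends x v)
        e₃ = edit-addEdge e₂ x≢v xv∉G₂
        uv∉G₃ : adj (result e₃) u v ≡ false
        uv∉G₃ = trans (adj-addEdge-other (result e₂) {u≢v = x≢v} (x≢u ∘ sym ∘ proj₁) (u≢v ∘ proj₁))
                 (trans (adj-removeEdge-other (result e₁) (u≢v ∘ proj₁) (z≢u ∘ sym ∘ proj₁))
                 (trans (adj-removeEdge-other G (x≢u ∘ sym ∘ proj₁) (x≢v ∘ sym ∘ proj₂)) uv∉G))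
        e : Edit G (λ y → ends x u y + ends v z y) (λ y → ends x v y + ends u v y)
        e = edit-addEdge e₃ u≢v uv∉G₃
        others : ∀ y → y ≢ v → ends x v y + ends u v y ≤ ends x u y + ends v z y
        others y y≢v rewrite ==-≢ y≢v | +-identityʳ (𝟙 (y == x)) | +-identityʳ (𝟙 (y == u)) = m≤m+n _ _
        at-v : deg G v + (ends x v v + ends u v v) ≤ d v + (ends x u v + ends v z v)
        at-v rewrite ends-right x≢v | ends-right u≢v | ends-outside (x≢v ∘ sym) (u≢v ∘ sym) | ends-left v≢z =
          room v-def 1
        balanced : Balanced (λ y → ends x u y + ends v z y) (λ y → ends x v y + ends u v y)
        balanced y y<r rewrite ==-≢ (below⇒≢v y<r) | ==-≢ (saturated≢deficient y<r z-def)
                             | +-identityʳ (𝟙 (y == x)) | +-identityʳ (𝟙 (y == u))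
                             | +-identityʳ (𝟙 (y == x) + 𝟙 (y == u)) = refl
        progress : ends x u v + ends v z v < ends x v v + ends u v v
        progress rewrite ends-right x≢v | ends-right u≢v | ends-outside (x≢v ∘ sym) (u≢v ∘ sym) | ends-left v≢z =
          s<s z<s

      Exchange : Fin n → Fin n → Fin n → Fin n → Set
      Exchange i j w w′ = toℕ i < r × r < toℕ j × r < toℕ w × r < toℕ w′ × adj G i w ≡ true × adj G j w′ ≡ true ×
                          w′ ≢ mate j × adj G v w ≡ false × adj G i j ≡ false

      exchange? : ∀ i j w w′ → Dec (Exchange i j w w′)
      exchange? i j w w′ = toℕ i <? r ×-dec r <? toℕ j ×-dec r <? toℕ w ×-dec r <? toℕ w′ ×-dec adj G i w ≟ᵇ true ×-dec
                           adj G j w′ ≟ᵇ true ×-dec ¬? (w′ ≟ᶠ mate j) ×-dec adj G v w ≟ᵇ false ×-dec adj G i j ≟ᵇ false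

      exchange : deg G v < d v → ∀ i j w w′ → Exchange i j w w′ → Improvement G
      exchange v-def i j w w′ (i<r , r<j , r<w , r<w′ , iw∈G , jw′∈G , w′≢mate , vw∉G , ij∉G) =
        raise e (bounded-except-v others at-v) balanced progress
        where
        i≢v : i ≢ v
        i≢v = below⇒≢v i<r
        v≢w : v ≢ w
        v≢w = above⇒≢v r<w ∘ sym
        v≢j : v ≢ j
        v≢j = above⇒≢v r<j ∘ sym
        v≢w′ : v ≢ w′
        v≢w′ = above⇒≢v r<w′ ∘ sym
        i≢w : i ≢ w
        i≢w = adj⇒≢ G iw∈G
        i≢j : i ≢ j
        i≢j = below≢above i<r r<j
        i≢w′ : i ≢ w′
        i≢w′ = below≢above i<r r<w′
        j≢w : j ≢ w
        j≢w = adj-separates G iw∈G ij∉G ∘ sym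
        e₁ : Edit G (ends i w) (λ _ → 0)
        e₁ = edit-removeEdge (unedited G (mates I)) iw∈G (mate-of-below i<r r<w)
        jw′∈G₁ : adj (result e₁) j w′ ≡ true
        jw′∈G₁ = trans (adj-removeEdge-other G (i≢j ∘ sym ∘ proj₁) (i≢w′ ∘ sym ∘ proj₂)) jw′∈G
        e₂ : Edit G (λ y → ends i w y + ends j w′ y) (λ _ → 0)
        e₂ = edit-removeEdge e₁ jw′∈G₁ w′≢mate
        vw∉G₂ : adj (result e₂) v w ≡ false
        vw∉G₂ = trans (adj-removeEdge-other (result e₁) (v≢j ∘ proj₁) (v≢w′ ∘ proj₁))
                      (trans (adj-removeEdge-other G (i≢v ∘ sym ∘ proj₁) (v≢w ∘ proj₁)) vw∉G)
        e₃ : Edit G (λ y → ends i w y + ends j w′ y) (ends v w)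
        e₃ = edit-addEdge e₂ v≢w vw∉G₂
        ij∉G₃ : adj (result e₃) i j ≡ false
        ij∉G₃ = trans (adj-addEdge-other (result e₂) {u≢v = v≢w} (i≢v ∘ proj₁) (i≢w ∘ proj₁))
                 (trans (adj-removeEdge-other (result e₁) (i≢j ∘ proj₁) (i≢w′ ∘ proj₁))
                 (trans (adj-removeEdge-other G (j≢w ∘ proj₂) (i≢w ∘ proj₁)) ij∉G))
        e : Edit G (λ y → ends i w y + ends j w′ y) (λ y → ends v w y + ends i j y)
        e = edit-addEdge e₃ i≢j ij∉G₃
        rearrange : ∀ a b c e → b + (a + c) ≤ a + b + (c + e)
        rearrange a b c e = begin
          b + (a + c)      ≡⟨ +-assoc b a c ⟨
          b + a + c        ≡⟨ cong (_+ c) (+-comm b a) ⟩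
          a + b + c        ≤⟨ +-monoʳ-≤ (a + b) (m≤m+n c e) ⟩
          a + b + (c + e)  ∎
          where open ≤-Reasoning
        others : ∀ y → y ≢ v → ends v w y + ends i j y ≤ ends i w y + ends j w′ y
        others y y≢v rewrite ==-≢ y≢v = rearrange (𝟙 (y == i)) (𝟙 (y == w)) (𝟙 (y == j)) (𝟙 (y == w′))
        at-v : deg G v + (ends v w v + ends i j v) ≤ d v + (ends i w v + ends j w′ v)
        at-v rewrite ends-left v≢w | ends-outside v≢j v≢w′ | ends-outside (i≢v ∘ sym) v≢j | ends-outside (i≢v ∘ sym) v≢w =
          room v-def 0
        balanced : Balanced (λ y → ends i w y + ends j w′ y) (λ y → ends v w y + ends i j y)
        balanced y y<r rewrite ==-≢ (below⇒≢v y<r) | ==-≢ (below≢above y<r r<w) | ==-≢ (below≢above y<r r<j)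
                             | ==-≢ (below≢above y<r r<w′) | +-identityʳ (𝟙 (y == i)) | +-identityʳ (𝟙 (y == i)) = refl
        progress : ends i w v + ends j w′ v < ends v w v + ends i j v
        progress rewrite ends-left v≢w | ends-outside v≢j v≢w′ | ends-outside (i≢v ∘ sym) v≢j | ends-outside (i≢v ∘ sym) v≢w =
          z<s

      Close : Fin n → Fin n → Fin n → Fin n → Set
      Close i j wᵢ wⱼ = toℕ i < r × toℕ j < r × i ≢ j × adj G i j ≡ false ×
                        r < toℕ wᵢ × adj G i wᵢ ≡ true × r < toℕ wⱼ × adj G j wⱼ ≡ true

      close? : ∀ i j wᵢ wⱼ → Dec (Close i j wᵢ wⱼ)
      close? i j wᵢ wⱼ = toℕ i <? r ×-dec toℕ j <? r ×-dec ¬? (i ≟ᶠ j) ×-dec adj G i j ≟ᵇ false ×-dec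
                         r <? toℕ wᵢ ×-dec adj G i wᵢ ≟ᵇ true ×-dec r <? toℕ wⱼ ×-dec adj G j wⱼ ≟ᵇ true

      close : ∀ i j wᵢ wⱼ → Close i j wᵢ wⱼ → Improvement G
      close i j wᵢ wⱼ (i<r , j<r , i≢j , ij∉G , r<wᵢ , iwᵢ∈G , r<wⱼ , jwⱼ∈G) =
        densify e bounded balanced v-balanced denser
        where
        e₁ : Edit G (ends i wᵢ) (λ _ → 0)
        e₁ = edit-removeEdge (unedited G (mates I)) iwᵢ∈G (mate-of-below i<r r<wᵢ)
        jwⱼ∈G₁ : adj (result e₁) j wⱼ ≡ true
        jwⱼ∈G₁ = trans (adj-removeEdge-other G (i≢j ∘ sym ∘ proj₁) (below≢above j<r r<wᵢ ∘ proj₁)) jwⱼ∈G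
        e₂ : Edit G (λ x → ends i wᵢ x + ends j wⱼ x) (λ _ → 0)
        e₂ = edit-removeEdge e₁ jwⱼ∈G₁ (mate-of-below j<r r<wⱼ)
        kept : ∀ {x y} → toℕ x < r → toℕ y < r → adj (result e₂) x y ≡ adj G x y
        kept x<r y<r = trans (adj-removeEdge-other (result e₁) (below≢above y<r r<wⱼ ∘ proj₂) (below≢above x<r r<wⱼ ∘ proj₁))
                             (adj-removeEdge-other G (below≢above y<r r<wᵢ ∘ proj₂) (below≢above x<r r<wᵢ ∘ proj₁))
        e : Edit G (λ x → ends i wᵢ x + ends j wⱼ x) (ends i j)
        e = edit-addEdge e₂ i≢j (trans (kept i<r j<r) ij∉G)
        bounded : Bounded (λ x → ends i wᵢ x + ends j wⱼ x) (ends i j)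
        bounded x = +-mono-≤ (deg≤d I x) (+-mono-≤ (m≤m+n (𝟙 (x == i)) _) (m≤m+n (𝟙 (x == j)) _))
        balanced : Balanced (λ x → ends i wᵢ x + ends j wⱼ x) (ends i j)
        balanced y y<r rewrite ==-≢ (below≢above y<r r<wᵢ) | ==-≢ (below≢above y<r r<wⱼ)
                             | +-identityʳ (𝟙 (y == i)) | +-identityʳ (𝟙 (y == j)) = refl
        v-balanced : ends i j v ≡ ends i wᵢ v + ends j wⱼ v
        v-balanced rewrite ends-outside (below⇒≢v i<r ∘ sym) (below⇒≢v j<r ∘ sym)
                         | ends-outside (below⇒≢v i<r ∘ sym) (above⇒≢v r<wᵢ ∘ sym)
                         | ends-outside (below⇒≢v j<r ∘ sym) (above⇒≢v r<wⱼ ∘ sym) = refl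
        inner-kept : ∀ {x y} → toℕ x < r → adj G x y ∧ earlier y ≡ true → adj (result e) x y ∧ earlier y ≡ true
        inner-kept {x} {y} x<r xy∈G = ∧-true
          (adj-addEdge-mono (result e₂) {i} {j} {x} {y} {i≢j} (trans (kept {x} {y} x<r (<ᵇ-true⁻¹ y<r)) (∧-trueˡ xy∈G))) y<r
          where
          y<r : earlier y ≡ true
          y<r = ∧-trueʳ {adj G x y} xy∈G
        row : SimpleGraph n → Fin n → ℕ
        row H x = if earlier x then count (λ y → adj H x y ∧ earlier y) else 0
        row-grows : ∀ x → row G x ≤ row (result e) x
        row-grows x with earlier x in x<r
        ... | false = z≤n
        ... | true  = count-mono (λ y → inner-kept {x} {y} (<ᵇ-true⁻¹ x<r))
        row-i-grows : row G i < row (result e) i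
        row-i-grows rewrite <ᵇ-true i<r = count-mono-< j (λ y → inner-kept {i} {y} i<r)
          (∧-true (adj-setEdge (result e₂) {ok = λ _ → i≢j}) (<ᵇ-true j<r)) (cong (_∧ earlier j) ij∉G)
        denser : density G < density (result e)
        denser = sum-mono-< i row-grows row-i-grows

      module Stuck (v-def : deg G v < d v)
        (no-link : ∀ z → ¬ Link z) (no-pull : ∀ x w → ¬ Pull x w) (no-insert : deg G v + 2 ≤ d v → ∀ x u → ¬ Insert x u)
        (no-reroute : ∀ a b z → ¬ Reroute a b z) (no-swap : ∀ x u z → ¬ Swap x u z)
        (no-exchange : ∀ i j w w′ → ¬ Exchange i j w w′) (no-close : ∀ i j wᵢ wⱼ → ¬ Close i j wᵢ wⱼ) where

        later-deficient : d v ≡ deg G v + 1 → ∃ λ z → r < toℕ z × deg G z < d z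
        later-deficient dv≡ with any? (λ z → (r <? toℕ z) ×-dec (deg G z <? d z))
        ... | yes found = found
        ... | no none = ⊥-elim (2≢1 (∣1⇒≡1 (∣m+n∣m⇒∣n (subst (2 ∣_) ∑d≡ 2∣∑d) (sum-deg-even G))))
          where
          2≢1 : 2 ≢ 1
          2≢1 ()
          deficit : Fin n → ℕ
          deficit x = d x ∸ deg G x
          deficit-elsewhere : ∀ x → x ≢ v → deficit x ≡ 0
          deficit-elsewhere x x≢v with <-cmpᶠ x v
          ... | tri< x<v _ _ = trans (cong (d x ∸_) (saturated I x x<v)) (n∸n≡0 (d x))
          ... | tri≈ _ x≡v _ = contradiction x≡v x≢v
          ... | tri> _ _ v<x = m≤n⇒m∸n≡0 (≮⇒≥ λ x-def → none (x , v<x , x-def))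
          ∑d≡ : sum d ≡ sum (deg G) + 1
          ∑d≡ = begin
            sum d                                ≡⟨ sum-cong-≗ (λ x → sym (m+[n∸m]≡n (deg≤d I x))) ⟩
            sum (λ x → deg G x + deficit x)      ≡⟨ ∑-distrib-+ (deg G) deficit ⟩
            sum (deg G) + sum deficit            ≡⟨ cong (sum (deg G) +_) (sum-single deficit v deficit-elsewhere) ⟩
            sum (deg G) + (d v ∸ deg G v)        ≡⟨ cong (λ k → sum (deg G) + (k ∸ deg G v)) dv≡ ⟩
            sum (deg G) + (deg G v + 1 ∸ deg G v) ≡⟨ cong (sum (deg G) +_) (m+n∸m≡n (deg G v) 1) ⟩
            sum (deg G) + 1                      ∎
            where open ≡-Reasoning

        deficiency-one : ¬ (deg G v + 2 ≤ d v) → d v ≡ deg G v + 1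
        deficiency-one v-def₂ = ≤-antisym (≤-pred (subst (d v <_) (+-suc (deg G v) 1) (≰⇒> v-def₂)))
                                          (subst (_≤ d v) (+-comm 1 (deg G v)) v-def)

        module NonNeighbour (i : Fin n) (i<r : toℕ i < r) (iv∉G : adj G i v ≡ false) where

          i≢v : i ≢ v
          i≢v = below⇒≢v i<r

          no-detour : ∀ u → adj G i u ≡ true → u ≢ mate i → adj G u v ≡ false → u ≢ v → ⊥
          no-detour u iu∈G u≢mate uv∉G u≢v with deg G v + 2 ≤? d v
          ... | yes v-def₂ = no-insert v-def₂ i u (i≢v , iv∉G , iu∈G , u≢mate , u≢v , uv∉G)
          ... | no ¬v-def₂ with later-deficient (deficiency-one ¬v-def₂)
          ...   | z , r<z , z-def with adj G v z in vz | z ≟ᶠ mate v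
          ...     | false | _         = no-link z (above⇒≢v r<z , vz , z-def)
          ...     | true  | no z≢mate = no-swap i u z (i≢v , iv∉G , iu∈G , u≢mate , u≢v , uv∉G , vz , z≢mate , z-def)
          ...     | true  | yes refl with adj G u (mate v) in uz
          ...       | true  = no-pull u (mate v) (u≢v , uv∉G , r<z , uz , u≢v ∘ sym ∘ mate-injective)
          ...       | false = no-reroute i u (mate v)
                                (iu∈G , u≢mate , i≢v , iv∉G , adj-separates G vz (adj-symᶠ G uv∉G) ∘ sym , uz , z-def , above⇒≢v r<z , u≢v)

          neighbour-of-i-adjacent-to-v : ∀ u → adj G i u ≡ true → u ≢ mate i → adj G u v ≡ true
          neighbour-of-i-adjacent-to-v u iu∈G u≢mate with adj G u v in uv
          ... | true  = refl
          ... | false = ⊥-elim (no-detour u iu∈G u≢mate uv (adj-separates G iu∈G iv∉G))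

          neighbour-of-i-is-earlier-neighbour-of-v : ∀ y → adj G i y ≡ true → y ≢ mate i → adj G v y ∧ earlier y ≡ true
          neighbour-of-i-is-earlier-neighbour-of-v y iy∈G y≢mate with <-cmpᶠ y v
          ... | tri< y<v _ _  = ∧-true (adj-symᵗ G (neighbour-of-i-adjacent-to-v y iy∈G y≢mate)) (<ᵇ-true y<v)
          ... | tri≈ _ refl _ = contradiction (trans (sym iy∈G) iv∉G) λ ()
          ... | tri> _ _ v<y  = ⊥-elim (no-pull i y (i≢v , iv∉G , v<y , iy∈G , mate-of-below i<r v<y))

          inside outside : ℕ
          inside  = count (λ y → adj G v y ∧ earlier y)
          outside = count (λ y → adj G v y ∧ not (earlier y))

          d-v≤1+inside : d v ≤ 1 + inside
          d-v≤1+inside = begin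
            d v              ≤⟨ d-noninc i v (<⇒≤ i<r) ⟩
            d i              ≡⟨ saturated I i i<r ⟨
            deg G i          ≡⟨ deg≡count G i ⟩
            count (adj G i)  ≤⟨ count-≤-except (adj G i) _ (mate i) neighbour-of-i-is-earlier-neighbour-of-v ⟩
            1 + inside       ∎
            where open ≤-Reasoning

          no-later-neighbour : outside ≡ 0
          no-later-neighbour = n<1⇒n≡0 (+-cancelˡ-< inside outside 1 (begin-strict
            inside + outside  ≡⟨ deg-split G earlier v ⟨
            deg G v           <⟨ v-def ⟩
            d v               ≤⟨ d-v≤1+inside ⟩
            1 + inside        ≡⟨ +-comm 1 inside ⟩
            inside + 1        ∎))
            where open ≤-Reasoning

          d-v≡deg+1 : d v ≡ deg G v + 1
          d-v≡deg+1 = ≤-antisym (≤-trans d-v≤1+inside (≤-reflexive (begin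
            1 + inside              ≡⟨ cong (1 +_) (trans (sym (+-identityʳ inside)) (cong (inside +_) (sym no-later-neighbour))) ⟩
            1 + (inside + outside)  ≡⟨ cong (1 +_) (deg-split G earlier v) ⟨
            1 + deg G v             ≡⟨ +-comm 1 (deg G v) ⟩
            deg G v + 1             ∎)))
            (subst (_≤ d v) (+-comm 1 (deg G v)) v-def)
            where open ≡-Reasoning

          absurd : ⊥
          absurd with later-deficient d-v≡deg+1
          ... | z , r<z , z-def with adj G v z in vz
          ...   | false = no-link z (above⇒≢v r<z , vz , z-def)
          ...   | true  = <-irrefl refl (subst (0 <_) no-later-neighbour
                            (count-pos (λ y → adj G v y ∧ not (earlier y)) (∧-true vz (cong not (<ᵇ-false (<⇒≤ r<z))))))

        earlier-adjacent-to-v : ∀ i → toℕ i < r → adj G i v ≡ true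
        earlier-adjacent-to-v i i<r with adj G i v in iv
        ... | true  = refl
        ... | false = ⊥-elim (NonNeighbour.absurd i i<r iv)

        prefix : Fin n → Bool
        prefix = below (suc r)

        count-prefix-except : ∀ x → prefix x ≡ true → count (λ y → prefix y ∧ not (y == x)) ≡ r
        count-prefix-except x x∈prefix = suc-injective (begin
          suc (count (λ y → prefix y ∧ not (y == x)))     ≡⟨ cong (λ b → 𝟙 b + count (λ y → prefix y ∧ not (y == x))) x∈prefix ⟨
          𝟙 (prefix x) + count (λ y → prefix y ∧ not (y == x)) ≡⟨ count-split-at prefix x ⟨
          count prefix                                    ≡⟨ count-below (suc r) (toℕ<n v) ⟩
          suc r                                           ∎)
          where open ≡-Reasoning

        r≤deg-v : r ≤ deg G v
        r≤deg-v = begin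
          r                 ≡⟨ count-below r (<⇒≤ (toℕ<n v)) ⟨
          count earlier  ≤⟨ count-mono (λ y y<r → adj-symᵗ G (earlier-adjacent-to-v y (<ᵇ-true⁻¹ y<r))) ⟩
          count (adj G v)   ≡⟨ deg≡count G v ⟨
          deg G v           ∎
          where open ≤-Reasoning

        has-later-neighbour : ∀ x y → toℕ x < r → toℕ y < r → x ≢ y → adj G x y ≡ false →
                              ∃ λ w → r < toℕ w × adj G x w ≡ true
        has-later-neighbour x y x<r y<r x≢y xy∉G =
          let w , e = count-witness (λ w → adj G x w ∧ not (prefix w)) (+-cancelˡ-< inside 0 _ (begin-strict
                inside + 0        ≡⟨ +-identityʳ inside ⟩
                inside            <⟨ inside<r ⟩
                r                 <⟨ ≤-<-trans r≤deg-v v-def ⟩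
                d v               ≤⟨ d-noninc x v (<⇒≤ x<r) ⟩
                d x               ≡⟨ saturated I x x<r ⟨
                deg G x           ≡⟨ deg-split G prefix x ⟩
                inside + count (λ w → adj G x w ∧ not (prefix w)) ∎))
          in w , <ᵇ-false⁻¹ (not-true (∧-trueʳ {adj G x w} e)) , ∧-trueˡ e
          where
          open ≤-Reasoning
          inside = count (λ w → adj G x w ∧ prefix w)
          inside<r : inside < r
          inside<r = subst (inside <_) (count-prefix-except x (<ᵇ-true (m<n⇒m<1+n x<r)))
            (count-mono-< y (λ w xw → ∧-true (∧-trueʳ {adj G x w} xw) (cong not (==-≢ (adj⇒≢ G (∧-trueˡ xw) ∘ sym))))
                         (∧-true (<ᵇ-true (m<n⇒m<1+n y<r)) (cong not (==-≢ (x≢y ∘ sym))))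
                         (cong (_∧ prefix y) xy∉G))

        earlier-clique : ∀ i j → toℕ i < r → toℕ j < r → i ≢ j → adj G i j ≡ true
        earlier-clique i j i<r j<r i≢j with adj G i j in ij
        ... | true  = refl
        ... | false with has-later-neighbour i j i<r j<r i≢j ij | has-later-neighbour j i j<r i<r (i≢j ∘ sym) (adj-symᶠ G ij)
        ...   | wᵢ , r<wᵢ , iwᵢ | wⱼ , r<wⱼ , jwⱼ = ⊥-elim (no-close i j wᵢ wⱼ (i<r , j<r , i≢j , ij , r<wᵢ , iwᵢ , r<wⱼ , jwⱼ))

        prefix-clique : ∀ x y → prefix x ≡ true → prefix y ≡ true → x ≢ y → adj G x y ≡ true
        prefix-clique x y x∈ y∈ x≢y with <-cmpᶠ x v | <-cmpᶠ y v
        ... | tri< x<v _ _  | tri< y<v _ _  = earlier-clique x y x<v y<v x≢y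
        ... | tri< x<v _ _  | tri≈ _ refl _ = earlier-adjacent-to-v x x<v
        ... | tri≈ _ refl _ | tri< y<v _ _  = adj-symᵗ G (earlier-adjacent-to-v y y<v)
        ... | tri≈ _ refl _ | tri≈ _ refl _ = contradiction refl x≢y
        ... | tri> _ _ v<x  | _             = contradiction (<ᵇ-true⁻¹ x∈) (<⇒≱ (s≤s v<x))
        ... | _             | tri> _ _ v<y  = contradiction (<ᵇ-true⁻¹ y∈) (<⇒≱ (s≤s v<y))

        prefix-row : ∀ x → prefix x ≡ true → r ≤ count (λ y → adj G x y ∧ prefix y)
        prefix-row x x∈ = subst (_≤ count (λ y → adj G x y ∧ prefix y)) (count-prefix-except x x∈)
          (count-mono λ y e → ∧-true (prefix-clique x y x∈ (∧-trueˡ e) (==-false⁻¹ (not-true (∧-trueʳ {prefix y} e)) ∘ sym))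
                                     (∧-trueˡ e))

        module ShortLater (j : Fin n) (r<j : r < toℕ j)
          (short : count (λ y → adj G j y ∧ prefix y) < capacity d (suc r) j) where

          j≢v : j ≢ v
          j≢v = above⇒≢v r<j

          inside outside : Fin n → ℕ
          inside  x = count (λ y → adj G x y ∧ prefix y)
          outside x = count (λ y → adj G x y ∧ not (prefix y))

          mate-leaves : 𝟙 (adj G j (mate j) ∧ not (prefix (mate j))) ≡ 𝟙 (not (partner (toℕ j) <ᵇ suc r))
          mate-leaves rewrite mates I j | toℕ-mate j = refl

          saturated-later-neighbour : deg G j ≡ d j → ∃ λ w′ → w′ ≢ mate j × r < toℕ w′ × adj G j w′ ≡ true
          saturated-later-neighbour j-sat =
            let w′ , w′≢mate , e = count-witness-≢ (λ y → adj G j y ∧ not (prefix y)) (mate j)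
                  (+-cancelˡ-< (inside j) _ _ (begin-strict
                    inside j + 𝟙 (adj G j (mate j) ∧ not (prefix (mate j))) ≡⟨ cong (inside j +_) mate-leaves ⟩
                    inside j + 𝟙 (not (partner (toℕ j) <ᵇ suc r))          <⟨ m<n∸o⇒m+o<n (d j) _ (<-≤-trans short (m⊓n≤m _ _)) ⟩
                    d j                                                   ≡⟨ j-sat ⟨
                    deg G j                                               ≡⟨ deg-split G prefix j ⟩
                    inside j + outside j                                  ∎))
            in w′ , w′≢mate , <ᵇ-false⁻¹ (not-true (∧-trueʳ {adj G j w′} e)) , ∧-trueˡ e
            where open ≤-Reasoning

          earlier-has-more-later-neighbours : ∀ i → toℕ i < r → outside v < outside i
          earlier-has-more-later-neighbours i i<r = +-cancelˡ-< r _ _ (begin-strict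
            r + outside v           ≤⟨ +-monoˡ-≤ (outside v) (prefix-row v (<ᵇ-true (n<1+n r))) ⟩
            inside v + outside v    ≡⟨ deg-split G prefix v ⟨
            deg G v                 <⟨ v-def ⟩
            d v                     ≤⟨ d-noninc i v (<⇒≤ i<r) ⟩
            d i                     ≡⟨ saturated I i i<r ⟨
            deg G i                 ≡⟨ deg-split G prefix i ⟩
            inside i + outside i    ≤⟨ +-monoˡ-≤ (outside i) inside-i≤r ⟩
            r + outside i           ∎)
            where
            open ≤-Reasoning
            inside-i≤r : inside i ≤ r
            inside-i≤r = ≤-pred (≤-trans (neighbours-in-prefix G {prefix} i (<ᵇ-true (m<n⇒m<1+n i<r)))
                                         (≤-reflexive (count-below (suc r) (toℕ<n v))))

          later-neighbour-of-i-missed-by-v : ∀ i → toℕ i < r → ∃ λ w → r < toℕ w × adj G i w ≡ true × adj G v w ≡ false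
          later-neighbour-of-i-missed-by-v i i<r =
            let w , iw , vw = count-<-witness (λ y → adj G v y ∧ not (prefix y)) (λ y → adj G i y ∧ not (prefix y))
                                              (earlier-has-more-later-neighbours i i<r)
                w-later = ∧-trueʳ {adj G i w} iw
            in w , <ᵇ-false⁻¹ (not-true w-later) , ∧-trueˡ iw , ∧-falseˡ vw w-later

          absurd : ⊥
          absurd with count-<-witness (λ y → adj G j y ∧ prefix y) prefix
                        (<-≤-trans short (≤-trans (m⊓n≤n _ _) (≤-reflexive (sym (count-below (suc r) (toℕ<n v))))))
          ... | i , i∈ , ji∉ = by-cases (<-cmpᶠ i v) (deg G j <? d j)
            where
            ji∉G : adj G j i ≡ false
            ji∉G = ∧-falseˡ ji∉ i∈
            later-neighbour-of-j : ¬ deg G j < d j → ∃ λ w′ → w′ ≢ mate j × r < toℕ w′ × adj G j w′ ≡ true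
            later-neighbour-of-j ¬j-def = saturated-later-neighbour (≤-antisym (deg≤d I j) (≮⇒≥ ¬j-def))
            by-cases : Tri (toℕ i < r) (i ≡ v) (r < toℕ i) → Dec (deg G j < d j) → ⊥
            by-cases (tri> _ _ v<i)  _           = contradiction (<ᵇ-true⁻¹ i∈) (<⇒≱ (s≤s v<i))
            by-cases (tri≈ _ refl _) (yes j-def) = no-link j (j≢v , adj-symᶠ G ji∉G , j-def)
            by-cases (tri≈ _ refl _) (no ¬j-def) =
              let w′ , w′≢mate , r<w′ , jw′∈G = later-neighbour-of-j ¬j-def
              in no-pull j w′ (j≢v , ji∉G , r<w′ , jw′∈G , w′≢mate)
            by-cases (tri< i<r _ _)  (yes j-def) =
              let w , r<w , iw∈G , vw∉G = later-neighbour-of-i-missed-by-v i i<r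
              in no-reroute w i j (adj-symᵗ G iw∈G , mate-of-above r<w i<r , above⇒≢v r<w , adj-symᶠ G vw∉G ,
                                   below≢above i<r r<j , adj-symᶠ G ji∉G , j-def , j≢v , below⇒≢v i<r)
            by-cases (tri< i<r _ _)  (no ¬j-def) =
              let w , r<w , iw∈G , vw∉G = later-neighbour-of-i-missed-by-v i i<r
                  w′ , w′≢mate , r<w′ , jw′∈G = later-neighbour-of-j ¬j-def
              in no-exchange i j w w′ (i<r , r<j , r<w , r<w′ , iw∈G , jw′∈G , w′≢mate , vw∉G , adj-symᶠ G ji∉G)

        later-capacity : ∀ j → r < toℕ j → capacity d (suc r) j ≤ count (λ y → adj G j y ∧ prefix y)
        later-capacity j r<j with capacity d (suc r) j ≤? count (λ y → adj G j y ∧ prefix y)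
        ... | yes enough = enough
        ... | no short   = ⊥-elim (ShortLater.absurd j r<j (≰⇒> short))

        absurd : ⊥
        absurd = <⇒≱ overfull (prefix-ok (suc r) (s≤s z≤n) (toℕ<n v))
          where
          open ≤-Reasoning
          deficit : Fin n → ℕ
          deficit x = d x ∸ deg G x
          prefix-deficit : sumOver prefix deficit ≡ deficit v
          prefix-deficit = trans (sum-single _ v elsewhere) (cong (λ b → if b then deficit v else 0) (<ᵇ-true (n<1+n r)))
            where
            elsewhere : ∀ x → x ≢ v → (if prefix x then deficit x else 0) ≡ 0
            elsewhere x x≢v with prefix x in x∈
            ... | false = refl
            ... | true  = trans (cong (d x ∸_) (saturated I x x<r)) (n∸n≡0 (d x))
              where
              x<r : toℕ x < r
              x<r = ≤∧≢⇒< (≤-pred (<ᵇ-true⁻¹ x∈)) (x≢v ∘ toℕ-injective)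
          overfull : prefixBound d (suc r) < sumOver prefix d
          overfull = begin-strict
            suc r * r + sumOver (not ∘ prefix) (capacity d (suc r))
              ≤⟨ +-mono-≤ rows (sumOver-mono-≤ (not ∘ prefix) λ j j∉ → later-capacity j (<ᵇ-false⁻¹ (not-true j∉))) ⟩
            sumOver prefix (λ x → count (λ y → adj G x y ∧ prefix y)) +
            sumOver (not ∘ prefix) (λ y → count (λ x → adj G y x ∧ prefix x))
              ≡⟨ prefix-degree-split G prefix ⟨
            sumOver prefix (deg G)
              <⟨ m<m+n _ (subst (0 <_) (sym prefix-deficit) (m<n⇒0<n∸m v-def)) ⟩
            sumOver prefix (deg G) + sumOver prefix deficit
              ≡⟨ sumOver-+ prefix (deg G) deficit ⟨
            sumOver prefix (λ x → deg G x + deficit x)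
              ≡⟨ sum-cong-≗ (λ x → cong (λ k → if prefix x then k else 0) (m+[n∸m]≡n (deg≤d I x))) ⟩
            sumOver prefix d ∎
            where
            rows : suc r * r ≤ sumOver prefix (λ x → count (λ y → adj G x y ∧ prefix y))
            rows = begin
              suc r * r                 ≡⟨ cong (_* r) (count-below (suc r) (toℕ<n v)) ⟨
              count prefix * r          ≡⟨ sumOver-const prefix r ⟨
              sumOver prefix (λ _ → r)  ≤⟨ sumOver-mono-≤ prefix prefix-row ⟩
              sumOver prefix (λ x → count (λ y → adj G x y ∧ prefix y)) ∎

  module _ (v : Fin n) where
    open AtVertex v

    module _ (G : SimpleGraph n) (I : Invariant r G) where
      open Moves G I

      improve : deg G v < d v → Improvement G
      improve v-def with any? link? | any²? pull? | deg G v + 2 ≤? d v ×-dec any²? insert? | any³? reroute? | any³? swap?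
                       | any⁴? exchange? | any⁴? close?
      ... | yes (z , p) | _ | _ | _ | _ | _ | _ = link v-def z p
      ... | no _ | yes (x , w , p) | _ | _ | _ | _ | _ = pull v-def x w p
      ... | no _ | no _ | yes (v-def₂ , x , u , p) | _ | _ | _ | _ = insert v-def₂ x u p
      ... | no _ | no _ | no _ | yes (a , b , z , p) | _ | _ | _ = reroute v-def a b z p
      ... | no _ | no _ | no _ | no _ | yes (x , u , z , p) | _ | _ = swap v-def x u z p
      ... | no _ | no _ | no _ | no _ | no _ | yes (i , j , w , w′ , p) | _ = exchange v-def i j w w′ p
      ... | no _ | no _ | no _ | no _ | no _ | no _ | yes (i , j , wᵢ , wⱼ , p) = close i j wᵢ wⱼ p
      ... | no ¬link | no ¬pull | no ¬insert | no ¬reroute | no ¬swap | no ¬exchange | no ¬close =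
        ⊥-elim (Stuck.absurd v-def (λ z p → ¬link (z , p)) (λ x w p → ¬pull (x , w , p))
                  (λ v-def₂ x u p → ¬insert (v-def₂ , x , u , p)) (λ a b z p → ¬reroute (a , b , z , p))
                  (λ x u z p → ¬swap (x , u , z , p)) (λ i j w w′ p → ¬exchange (i , j , w , w′ , p))
                  (λ i j wᵢ wⱼ p → ¬close (i , j , wᵢ , wⱼ , p)))

    saturate : ∀ G → Invariant r G → Acc _⊏_ G → Σ[ G′ ∈ SimpleGraph n ] Invariant (suc r) G′
    saturate G I (acc smaller) with deg G v <? d v
    ... | yes v-def = let G′ , I′ , G′⊏G = improve G I v-def in saturate G′ I′ (smaller G′⊏G)
    ... | no ¬v-def = G , record { mates = mates I ; deg≤d = deg≤d I ; saturated = saturated′ }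
      where
      saturated′ : ∀ x → toℕ x < suc r → deg G x ≡ d x
      saturated′ x x≤r with <-cmpᶠ x v
      ... | tri< x<v _ _  = saturated I x x<v
      ... | tri≈ _ refl _ = ≤-antisym (deg≤d I x) (≮⇒≥ ¬v-def)
      ... | tri> _ _ v<x  = contradiction x≤r (<⇒≱ (s≤s v<x))

  module _ (d-pos : ∀ x → 1 ≤ d x) where

    build : ∀ k → k ≤ n → Σ[ G ∈ SimpleGraph n ] Invariant k G
    build zero    _   = matching , record
      { mates = ==-refl ∘ mate ; deg≤d = λ x → subst (_≤ d x) (sym (deg-matching x)) (d-pos x) ; saturated = λ _ () }
    build (suc k) k<n =
      let G , I = build k (<⇒≤ k<n)
          v = fromℕ< k<n
          G′ , I′ = saturate v G (subst (λ r → Invariant r G) (sym (toℕ-fromℕ< k<n)) I) (AtVertex.⊏-wellFounded v G)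
      in G′ , subst (λ r → Invariant (suc r) G′) (toℕ-fromℕ< k<n) I′

    realisation : Σ[ G ∈ SimpleGraph n ] (∀ x → deg G x ≡ d x) × ContainsM⁺ G
    realisation = let G , I = build n ≤-refl in G , (λ x → saturated I x (toℕ<n x)) , λ x → mate x , toℕ-mate x , mates I x

-- The indexing conventions of the statement

sum-applyUpTo : ∀ {n} (h : ℕ → ℕ) → List.sum (applyUpTo h n) ≡ sum (λ (x : Fin n) → h (toℕ x))
sum-applyUpTo {zero}  h = refl
sum-applyUpTo {suc n} h = cong (h 0 +_) (sum-applyUpTo {n} (h ∘ suc))

sum-applyUpTo-below : ∀ (g : ℕ → ℕ) k m → k ≤ m →
                      List.sum (applyUpTo (λ t → if t <ᵇ k then g t else 0) m) ≡ List.sum (applyUpTo g k)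
sum-applyUpTo-below g zero    m       _         = trans (sum-applyUpTo {m} (λ _ → 0)) (sum-zero {m} λ _ → refl)
sum-applyUpTo-below g (suc k) (suc m) (s≤s k≤m) = cong (g 0 +_) (sum-applyUpTo-below (g ∘ suc) k m k≤m)

sum-applyUpTo-from : ∀ (g : ℕ → ℕ) a m →
                     List.sum (applyUpTo (λ t → if not (t <ᵇ a) then g (suc t) else 0) m) ≡
                     List.sum (applyUpTo (λ t → g (suc a + t)) (m ∸ a))
sum-applyUpTo-from g zero    m       = refl
sum-applyUpTo-from g (suc a) zero    = refl
sum-applyUpTo-from g (suc a) (suc m) = sum-applyUpTo-from (g ∘ suc) a m

sumFT≡sum-applyUpTo : ∀ g a b → sumFT g a b ≡ List.sum (applyUpTo (λ t → g (a + t)) (suc b ∸ a))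
sumFT≡sum-applyUpTo g a b = cong List.sum (map-upTo (λ t → g (a + t)) (suc b ∸ a))

ext-lookup : ∀ {n} (d : Fin n → ℕ) (x : Fin n) → ext d (suc (toℕ x)) ≡ d x
ext-lookup {suc n} d Fin.zero    = refl
ext-lookup {suc n} d (Fin.suc x) = ext-lookup (d ∘ Fin.suc) x

ext-beyond : ∀ {n} (d : Fin n → ℕ) m → n ≤ m → ext d (suc m) ≡ 0
ext-beyond {zero}  d m       _         = refl
ext-beyond {suc n} d (suc m) (s≤s n≤m) = ext-beyond (d ∘ Fin.suc) m n≤m

sumFT-prefix : ∀ {n} (d : Fin n → ℕ) k → k ≤ n → sumFT (ext d) 1 k ≡ sumOver (below k) d
sumFT-prefix {n} d k k≤n = begin
  sumFT (ext d) 1 k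
    ≡⟨ sumFT≡sum-applyUpTo (ext d) 1 k ⟩
  List.sum (applyUpTo (ext d ∘ suc) k)
    ≡⟨ sum-applyUpTo-below (ext d ∘ suc) k n k≤n ⟨
  List.sum (applyUpTo (λ t → if t <ᵇ k then ext d (suc t) else 0) n)
    ≡⟨ sum-applyUpTo {n} (λ t → if t <ᵇ k then ext d (suc t) else 0) ⟩
  sumOver (below {n} k) (λ x → ext d (suc (toℕ x)))
    ≡⟨ sumOver-cong (below {n} k) (λ x _ → ext-lookup d x) ⟩
  sumOver (below k) d ∎
  where open ≡-Reasoning

sumFT-suffix : ∀ {n} (g : ℕ → ℕ) a → sumFT g (suc a) n ≡ sumOver (not ∘ below {n} a) (λ x → g (suc (toℕ x)))
sumFT-suffix {n} g a = begin
  sumFT g (suc a) n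
    ≡⟨ sumFT≡sum-applyUpTo g (suc a) n ⟩
  List.sum (applyUpTo (λ t → g (suc a + t)) (n ∸ a))
    ≡⟨ sum-applyUpTo-from g a n ⟨
  List.sum (applyUpTo (λ t → if not (t <ᵇ a) then g (suc t) else 0) n)
    ≡⟨ sum-applyUpTo {n} (λ t → if not (t <ᵇ a) then g (suc t) else 0) ⟩
  sumOver (not ∘ below {n} a) (λ x → g (suc (toℕ x))) ∎
  where open ≡-Reasoning

capacity-beyond : ∀ {n} (d : Fin n → ℕ) k x → k < toℕ x → capacity d k x ≡ (ext d (suc (toℕ x)) ∸ 1) ⊓ k
capacity-beyond d k x k<x rewrite <ᵇ-false (≤-partner k<x) | ext-lookup d x = refl

capacity-at : ∀ {n} (d : Fin n → ℕ) k x → toℕ x ≡ k →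
              capacity d k x ≡ (ext d (suc k) ∸ 𝟙 (isEven k)) ⊓ k
capacity-at d k x refl with isEven (toℕ x) in even
... | true  rewrite partner-even (toℕ x) even | <ᵇ-false (n≤1+n (toℕ x)) | ext-lookup d x = refl
... | false rewrite <ᵇ-true (≤-reflexive (partner-odd (toℕ x) even)) | ext-lookup d x = refl

capacity-even : ∀ {n} (d : Fin n → ℕ) {k} x → isEven k ≡ true → k ≤ toℕ x →
                capacity d k x ≡ (ext d (suc (toℕ x)) ∸ 1) ⊓ k
capacity-even d x even k≤x with m≤n⇒m<n∨m≡n k≤x
... | inj₁ k<x  = capacity-beyond d _ x k<x
... | inj₂ refl = trans (capacity-at d _ x refl) (cong (λ b → (ext d (suc (toℕ x)) ∸ 𝟙 b) ⊓ toℕ x) even)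

capacity-sum-even : ∀ {n} (d : Fin n → ℕ) k → isEven k ≡ true →
                    sumOver (not ∘ below {n} k) (capacity d k) ≡ sumFT (λ i → (ext d i ∸ 1) ⊓ k) (suc k) n
capacity-sum-even {n} d k even =
  trans (sumOver-cong (not ∘ below k) (λ x x∉ → capacity-even d x even (<ᵇ-false⁻¹ (not-true x∉))))
        (sym (sumFT-suffix (λ i → (ext d i ∸ 1) ⊓ k) k))

at : ∀ {n} → ℕ → Fin n → Bool
at k x = does (toℕ x ≟ k)

sumOver-split-at : ∀ {n} k (f : Fin n → ℕ) →
                   sumOver (not ∘ below k) f ≡ sumOver (at k) f + sumOver (not ∘ below (suc k)) f
sumOver-split-at {n} k f = trans (sum-cong-≗ pointwise) (∑-distrib-+ (λ x → if at k x then f x else 0) _)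
  where
  pointwise : ∀ x → (if not (below k x) then f x else 0) ≡
                    (if at k x then f x else 0) + (if not (below (suc k) x) then f x else 0)
  pointwise x with <-cmp (toℕ x) k
  ... | tri< x<k x≢k _ rewrite <ᵇ-true x<k | dec-false (toℕ x ≟ k) x≢k | <ᵇ-true (m<n⇒m<1+n x<k) = refl
  ... | tri≈ _ refl _ rewrite <ᵇ-false (≤-refl {toℕ x}) | dec-true (toℕ x ≟ toℕ x) refl | <ᵇ-true (n<1+n (toℕ x)) =
    sym (+-identityʳ (f x))
  ... | tri> _ x≢k k<x rewrite <ᵇ-false (<⇒≤ k<x) | dec-false (toℕ x ≟ k) x≢k | <ᵇ-false k<x = refl

capacity-sum-at-odd : ∀ {n} (d : Fin n → ℕ) k → isEven k ≡ false → sumOver (at k) (capacity d k) ≡ ext d (suc k) ⊓ k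
capacity-sum-at-odd {n} d k odd with k <? n
... | yes k<n = begin
  sumOver (at k) (capacity d k)           ≡⟨ sum-single _ x₀ elsewhere ⟩
  (if at k x₀ then capacity d k x₀ else 0) ≡⟨ cong (λ b → if b then capacity d k x₀ else 0) (dec-true (toℕ x₀ ≟ k) x₀≡k) ⟩
  capacity d k x₀                          ≡⟨ capacity-at d k x₀ x₀≡k ⟩
  (ext d (suc k) ∸ 𝟙 (isEven k)) ⊓ k       ≡⟨ cong (λ b → (ext d (suc k) ∸ 𝟙 b) ⊓ k) odd ⟩
  ext d (suc k) ⊓ k                        ∎
  where
  open ≡-Reasoning
  x₀ : Fin n
  x₀ = fromℕ< k<n
  x₀≡k : toℕ x₀ ≡ k
  x₀≡k = toℕ-fromℕ< k<n
  elsewhere : ∀ x → x ≢ x₀ → (if at k x then capacity d k x else 0) ≡ 0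
  elsewhere x x≢x₀ rewrite dec-false (toℕ x ≟ k) (λ x≡k → x≢x₀ (toℕ-injective (trans x≡k (sym x₀≡k)))) = refl
... | no  k≮n = trans (sum-zero nowhere) (cong (_⊓ k) (sym (ext-beyond d k (≮⇒≥ k≮n))))
  where
  nowhere : ∀ x → (if at k x then capacity d k x else 0) ≡ 0
  nowhere x rewrite dec-false (toℕ x ≟ k) (λ { refl → k≮n (toℕ<n x) }) = refl

capacity-sum-odd : ∀ {n} (d : Fin n → ℕ) k → isEven k ≡ false →
                   sumOver (not ∘ below {n} k) (capacity d k) ≡
                   ext d (suc k) ⊓ k + sumFT (λ i → (ext d i ∸ 1) ⊓ k) (suc (suc k)) n
capacity-sum-odd {n} d k odd = begin
  sumOver (not ∘ below k) (capacity d k)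
    ≡⟨ sumOver-split-at k (capacity d k) ⟩
  sumOver (at k) (capacity d k) + sumOver (not ∘ below (suc k)) (capacity d k)
    ≡⟨ cong₂ _+_ (capacity-sum-at-odd d k odd) (sumOver-cong (not ∘ below {n} (suc k)) beyond) ⟩
  ext d (suc k) ⊓ k + sumOver (not ∘ below {n} (suc k)) (λ x → (ext d (suc (toℕ x)) ∸ 1) ⊓ k)
    ≡⟨ cong (ext d (suc k) ⊓ k +_) (sumFT-suffix {n} (λ i → (ext d i ∸ 1) ⊓ k) (suc k)) ⟨
  ext d (suc k) ⊓ k + sumFT (λ i → (ext d i ∸ 1) ⊓ k) (suc (suc k)) n ∎
  where
  open ≡-Reasoning
  beyond : ∀ x → not (below (suc k) x) ≡ true → capacity d k x ≡ (ext d (suc (toℕ x)) ∸ 1) ⊓ k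
  beyond x x∉ = capacity-beyond d k x (<ᵇ-false⁻¹ (not-true x∉))

bound≡prefixBound : ∀ {n} (d : Fin n → ℕ) k → bound d k ≡ prefixBound d k
bound≡prefixBound d k with isEven k in parity
... | true  = cong (k * (k ∸ 1) +_) (sym (capacity-sum-even d k parity))
... | false = cong (k * (k ∸ 1) +_) (sym (capacity-sum-odd d k parity))

realisable⇔ : ∀ {n} (d : Fin n → ℕ) → NonIncreasing d → (∀ i → 1 ≤ d i) →
              (∃[ G ] ((∀ i → deg G i ≡ d i) × ContainsM⁺ G)) ⇔
              (2 ∣ sum d × 2 ∣ n × (∀ k → 1 ≤ k → k ≤ n → sumOver (below k) d ≤ prefixBound d k))
realisable⇔ {n} d d-noninc d-pos = mk⇔ necessary sufficient
  where
  necessary : ∃[ G ] ((∀ i → deg G i ≡ d i) × ContainsM⁺ G) →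
              2 ∣ sum d × 2 ∣ n × (∀ k → 1 ≤ k → k ≤ n → sumOver (below k) d ≤ prefixBound d k)
  necessary (G , deg≡d , M⁺⊆G) =
      subst (2 ∣_) (sum-cong-≗ deg≡d) (sum-deg-even G)
    , ContainsM⁺⇒2∣n G M⁺⊆G
    , λ k _ k≤n → subst₂ _≤_ (sumOver-cong (below k) (λ x _ → deg≡d x)) (prefixBound-cong deg≡d k)
                            (prefix-inequality G M⁺⊆G k k≤n)
  sufficient : 2 ∣ sum d × 2 ∣ n × (∀ k → 1 ≤ k → k ≤ n → sumOver (below k) d ≤ prefixBound d k) →
               ∃[ G ] ((∀ i → deg G i ≡ d i) × ContainsM⁺ G)
  sufficient (2∣∑d , 2∣n , prefix-ok) = Sufficiency.realisation d 2∣n d-noninc 2∣∑d prefix-ok d-pos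

conditions⇔ : ∀ {n} (d : Fin n → ℕ) →
              (2 ∣ sum d × 2 ∣ n × (∀ k → 1 ≤ k → k ≤ n → sumOver (below k) d ≤ prefixBound d k)) ⇔
              (2 ∣ sumFT (ext d) 1 n × 2 ∣ n × (∀ k → 1 ≤ k → k ≤ n → sumFT (ext d) 1 k ≤ bound d k))
conditions⇔ {n} d = mk⇔ (subst (2 ∣_) (sym total)) (subst (2 ∣_) total) ×-⇔ ⇔-refl ×-⇔ mk⇔
  (λ ok k 1≤k k≤n → subst₂ _≤_ (sym (sumFT-prefix d k k≤n)) (sym (bound≡prefixBound d k)) (ok k 1≤k k≤n))
  (λ ok k 1≤k k≤n → subst₂ _≤_ (sumFT-prefix d k k≤n) (bound≡prefixBound d k) (ok k 1≤k k≤n))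
  where
  total : sumFT (ext d) 1 n ≡ sum d
  total = trans (sumFT-prefix d n ≤-refl) (sum-cong-≗ λ x → cong (λ b → if b then d x else 0) (<ᵇ-true (toℕ<n x)))

theorem4 : (n : ℕ) (d : Fin n → ℕ) →
    NonIncreasing d → (∀ i → 1 ≤ d i) →
    (∃[ G ] ((∀ i → deg G i ≡ d i) × ContainsM⁺ G))
      ⇔ ((2 ∣ sumFT (ext d) 1 n) × (2 ∣ n) ×
         (∀ k → 1 ≤ k → k ≤ n → sumFT (ext d) 1 k ≤ bound d k))
theorem4 n d d-noninc d-pos = ⇔-trans (realisable⇔ d d-noninc d-pos) (conditions⇔ d)
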